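{- The class of languages and functions computable by step Turing machines is the same as the class of languages and functions computable by classical Turing machines: a (partial) function $f:\{0,1\}^*\to\{0,1\}^*$ (resp. a language over $\{0,1\}$) is computed by some step Turing machine if and only if it is computed by some classical Turing machine.
   Context: Let $\Sigma$ be a finite alphabet of atomic actions and $\mathsf{SCP}(\Sigma)$ the set of steps over $\Sigma$ (finite multisets of actions with no order between them). A step Turing machine (STM) is $M=(Q,q_0,F,\Sigma,\Gamma,\delta,\gamma,\eta)$ where $Q$ is a finite set of control states, $q_0\in Q$ initial, $F\subseteq Q$ final, $\Gamma=\{0,1,\square\}$ the tape symbols ($\square$ blank). The machine has three kinds of tapes: a read-only input tape whose head moves only right, a write-only output tape whose head moves only right, and a planar step tape consisting of finitely many (a bounded number $k$ of) parallel infinite tapes whose heads move together left or right. Transitions: $\delta$ (input reading): in state $q_i$ reading a symbol from the input tape, perform the empty action $1$, write that symbol into a specified cell of the planar tape, move the input head right and go to $q_j$; $\gamma$ (output writing): in state $q_i$, read a specified cell of the planar tape, write its symbol on the output tape, perform $1$, move the output head right and go to $q_j$; $\eta$ (step transitions): $(Q\setminus F)\times U\times(\Gamma\cup\{\epsilon\})^{\langle k\rangle}\to Q\times(\Gamma\cup\{\epsilon\})^{\langle k\rangle}\times\{L,R\}$ with $U\in\mathsf{SCP}(\Sigma)$: in state $q_i$, reading a column of $k$ symbols of the planar tape in parallel ($\epsilon$ meaning an empty part of the tape), perform the step of actions $U$, replace them by a new column of $k$ symbols ($\epsilon$ erasing), move all planar heads one cell left or right, and go to $q_j$. The STM is off-line: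 the input $w\in\{0,1\}^*$ is written on the input tape with the head on its leftmost nonblank cell; the output is the content of the output tape (an element of $\{0,1\}^*$) when the machine halts in a final state. An STM computes $f$ if for all inputs $w$ it produces output $f(w)$. -}

module Defs where

open import Data.Bool using (Bool; true; false)
open import Data.Nat using (ℕ)
open import Data.Fin using (Fin)
open import Data.List using (List; []; _∷_; map; reverse)
open import Data.Vec using (Vec; replicate; lookup; _[_]≔_)
open import Data.Maybe using (Maybe; just; nothing)
open import Data.Product using (Σ; _×_; _,_; ∃)
open import Relation.Binary.PropositionalEquality using (_≡_)
open import Relation.Binary.Construct.Closure.ReflexiveTransitive using (Star)
open import Function.Bundles using (_⇔_)

data Γ : Set where
  𝟘 𝟙 □ : Γ

bit : Bool → Γ
bit false = 𝟘
bit true  = 𝟙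

data Dir : Set where
  L R : Dir

-- A two-way infinite tape as a zipper; cells outside the stored part
-- hold the default symbol d.
record Tape (A : Set) : Set where
  constructor tape
  field
    left  : List A   -- cells to the left of the head, nearest first
    cur   : A
    right : List A   -- cells to the right of the head, nearest first
open Tape public

move : {A : Set} → A → Dir → Tape A → Tape A
move d L (tape []      c r) = tape [] d (c ∷ r)
move d L (tape (x ∷ l) c r) = tape l x (c ∷ r)
move d R (tape l c [])      = tape (c ∷ l) d []
move d R (tape l c (x ∷ r)) = tape (c ∷ l) x r

writeCur : {A : Set} → A → Tape A → Tape A
writeCur a (tape l _ r) = tape l a r

-- a (partial) function {0,1}* ⇀ {0,1}* given by its graph
Functional : (List Bool → List Bool → Set) → Set
Functional F = ∀ {w v v'} → F w v → F w v' → v ≡ v'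

-- a step over Σ = Fin s : a finite multiset of actions (multiplicity function)
SCP : ℕ → Set
SCP s = Fin s → ℕ

-- contents of a planar-tape cell: a symbol of Γ or ε (nothing = empty)
Cell : Set
Cell = Maybe Γ

data Instr (s k n : ℕ) : Set where
  -- δ : read input symbol a, perform 1, write a into row i of the current
  --     planar column, move input head right, go to state q
  readIn   : (Γ → Fin k × Fin n) → Instr s k n
  -- γ : read row i of the current planar column, write it on the output
  --     tape, perform 1, move output head right, go to state q
  writeOut : Fin k → Fin n → Instr s k n
  -- η : reading a column of k cells, perform step U, write a new column,
  --     move all planar heads, go to a new state (undefined = nothing)
  stepη    : (Vec Cell k → Maybe (SCP s × Vec Cell k × Dir × Fin n)) → Instr s k n

record STM (s : ℕ) : Set where
  field
    k     : ℕ                -- number of parallel planar tapes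
    nQ    : ℕ
    q₀    : Fin nQ
    final : Fin nQ → Bool
    instr : Fin nQ → Instr s k nQ

module _ {s : ℕ} (M : STM s) where
  open STM M

  emptyCol : Vec Cell k
  emptyCol = replicate k nothing

  record SConf : Set where
    constructor sconf
    field
      state  : Fin nQ
      input  : List Bool         -- unread part of the input tape
      planar : Tape (Vec Cell k)
      output : List Cell         -- output tape contents, reversed

  headIn : List Bool → Γ
  headIn []      = □
  headIn (b ∷ _) = bit b

  tailIn : List Bool → List Bool
  tailIn []      = []
  tailIn (_ ∷ w) = w

  data SStep : SConf → SConf → Set where
    δ-step : ∀ {q w P o f i q'} → final q ≡ false → instr q ≡ readIn f →
             f (headIn w) ≡ (i , q') →
             SStep (sconf q w P o)
                   (sconf q' (tailIn w) (writeCur (cur P [ i ]≔ just (headIn w)) P) o)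
    γ-step : ∀ {q w P o i q'} → final q ≡ false → instr q ≡ writeOut i q' →
             SStep (sconf q w P o) (sconf q' w P (lookup (cur P) i ∷ o))
    η-step : ∀ {q w P o g U col d q'} → final q ≡ false → instr q ≡ stepη g →
             g (cur P) ≡ just (U , col , d , q') →
             SStep (sconf q w P o) (sconf q' w (move emptyCol d (writeCur col P)) o)

  sinit : List Bool → SConf
  sinit w = sconf q₀ w (tape [] emptyCol []) []

  STMOutputs : List Bool → List Bool → Set
  STMOutputs w v = ∃ λ c → Star SStep (sinit w) c × final (SConf.state c) ≡ true
                         × reverse (SConf.output c) ≡ map (λ b → just (bit b)) v

STMComputes : {s : ℕ} → STM s → (List Bool → List Bool → Set) → Set
STMComputes M F = ∀ w v → (STMOutputs M w v ⇔ F w v)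

STMAccepts : {s : ℕ} → STM s → List Bool → Set
STMAccepts M w = ∃ λ v → STMOutputs M w v

STMRecognizes : {s : ℕ} → STM s → (List Bool → Set) → Set
STMRecognizes M Lang = ∀ w → (STMAccepts M w ⇔ Lang w)

record TM : Set where
  field
    nQ    : ℕ
    q₀    : Fin nQ
    final : Fin nQ → Bool
    δ     : Fin nQ → Γ → Maybe (Fin nQ × Γ × Dir)

module _ (M : TM) where
  open TM M

  record TConf : Set where
    constructor tconf
    field
      state : Fin nQ
      tp    : Tape Γ

  data TStep : TConf → TConf → Set where
    t-step : ∀ {q T q' a d} → final q ≡ false → δ q (cur T) ≡ just (q' , a , d) →
             TStep (tconf q T) (tconf q' (move □ d (writeCur a T)))

  inputTape : List Bool → Tape Γ
  inputTape []      = tape [] □ []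
  inputTape (b ∷ w) = tape [] (bit b) (map bit w)

  tinit : List Bool → TConf
  tinit w = tconf q₀ (inputTape w)

  -- the output is the maximal blank-free word starting at the head
  data ReadsWord : Tape Γ → List Bool → Set where
    rw-end  : ∀ {T} → cur T ≡ □ → ReadsWord T []
    rw-cons : ∀ {T b v} → cur T ≡ bit b → ReadsWord (move □ R T) v → ReadsWord T (b ∷ v)

  TMOutputs : List Bool → List Bool → Set
  TMOutputs w v = ∃ λ c → Star TStep (tinit w) c × final (TConf.state c) ≡ true
                        × ReadsWord (TConf.tp c) v

TMComputes : TM → (List Bool → List Bool → Set) → Set
TMComputes M F = ∀ w v → (TMOutputs M w v ⇔ F w v)

TMAccepts : TM → List Bool → Set
TMAccepts M w = ∃ λ v → TMOutputs M w v

TMRecognizes : TM → (List Bool → Set) → Set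
TMRecognizes M Lang = ∀ w → (TMAccepts M w ⇔ Lang w)

{-# OPTIONS --safe #-}
module Submission where

open import Data.Bool using (Bool; true; false; if_then_else_; not)
open import Data.Empty using (⊥; ⊥-elim)
open import Data.Fin using (Fin; zero; suc; toℕ; inject₁; fromℕ; _↑ˡ_; _↑ʳ_; splitAt; combine; remQuot)
open import Data.Fin.Patterns using (0F; 1F; 2F; 3F; 4F; 5F; 6F; 7F)
open import Data.Fin.Properties using (toℕ-inject₁; toℕ-fromℕ; splitAt-↑ˡ; splitAt-↑ʳ; remQuot-combine)
open import Data.List using (List; []; _∷_; _++_; reverse; map; length; replicate; null; _ʳ++_; InitLast; _∷ʳ′_; initLast)
open import Data.List.Properties using (++-assoc; unfold-reverse; reverse-involutive; ++-identityʳ; length-reverse; length-map; length-replicate; map-++; reverse-++; ∷-injective; ʳ++-defn; map-injective)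
open import Data.List.Relation.Unary.All using (All; []; _∷_)
open import Data.List.Relation.Unary.All.Properties using (++⁺; ∷ʳ⁻; replicate⁺)
open import Data.Maybe using (Maybe; just; nothing)
open import Data.Nat using (ℕ; zero; suc; _+_; _*_; _<_; _≤_; s≤s)
open import Data.Nat.Properties using (suc-injective; +-suc; +-comm; ≤-refl; ≤-trans; ≤-reflexive; m≤m+n)
open import Data.Product using (Σ; _×_; _,_; proj₁; proj₂; ∃)
open import Data.Sum using (_⊎_; inj₁; inj₂)
import Data.Sum
import Data.Product
open import Data.Unit using (⊤; tt)
open import Data.Vec using (Vec; []; _∷_; toList; lookup; _[_]≔_)
import Data.Vec as Vec
open import Data.Vec.Properties using (toList-∷ʳ; length-toList; toList-replicate; toList-injective; cast-is-id; ++-injectiveˡ; ++-injectiveʳ; take++drop≡id)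
open import Function using (case_of_; _∘_; id; it)
open import Function.Bundles using (_⇔_; mk⇔; Equivalence)
import Function.Properties.Equivalence as ⇔
open import Relation.Binary.PropositionalEquality
open import Relation.Binary.Construct.Closure.ReflexiveTransitive using (Star; ε; _◅_; _◅◅_)
open import Defs

-- Both machine models are deterministic and each simulates the other step by step, so a
-- halting run of the simulator corresponds exactly to a halting run of the simulated machine
-- and the two produce the same outputs on every input.
--
-- A Turing machine is run by a step Turing machine with a single planar row: the input is
-- first copied onto the row, the moves of the Turing machine are replayed cell by cell, and
-- the word under the head is finally copied to the output tape.
--
-- A step Turing machine with k rows is run by a Turing machine whose tape carries, from left
-- to right, the planar tape folded at its origin into blocks of 3 + 4k bits (two bits per
-- cell, one column from each half of the planar tape, and flags for the head block, the half
-- holding the head and the origin block), a gap of blanks, the unread input and the output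
-- written so far. A step is simulated by reading the head block into the finite control and
-- rewriting it, and then either moving the head flag to a neighbouring block (creating a fresh
-- block at the left end if needed) or travelling right to turn the next input bit into a gap
-- blank or to append an output bit, and coming back. A machine that writes a non-bit to its
-- output can never produce an output; the simulator then gets stuck instead of halting.

-- The stored part of a Tape may carry any number of trailing default cells,
-- so tapes are compared up to _∼_, equality of lists up to trailing d's.
module UpToPadding {A : Set} (d : A) where

  infix 4 _∼_
  data _∼_ : List A → List A → Set where
    nil  : [] ∼ []
    cons : ∀ x {l l'} → l ∼ l' → (x ∷ l) ∼ (x ∷ l')
    padˡ : ∀ {l} → l ∼ [] → (d ∷ l) ∼ []
    padʳ : ∀ {l} → [] ∼ l → [] ∼ (d ∷ l)

  hd : List A → A
  hd []      = d
  hd (x ∷ _) = x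

  tl : List A → List A
  tl []      = []
  tl (_ ∷ l) = l

  ∼-hd : ∀ {l l'} → l ∼ l' → hd l ≡ hd l'
  ∼-hd nil        = refl
  ∼-hd (cons x p) = refl
  ∼-hd (padˡ p)   = refl
  ∼-hd (padʳ p)   = refl

  ∼-tl : ∀ {l l'} → l ∼ l' → tl l ∼ tl l'
  ∼-tl nil        = nil
  ∼-tl (cons x p) = p
  ∼-tl (padˡ p)   = p
  ∼-tl (padʳ p)   = p

  ∼-refl : ∀ l → l ∼ l
  ∼-refl []      = nil
  ∼-refl (x ∷ l) = cons x (∼-refl l)

  ∼-sym : ∀ {l l'} → l ∼ l' → l' ∼ l
  ∼-sym nil        = nil
  ∼-sym (cons x p) = cons x (∼-sym p)
  ∼-sym (padˡ p)   = padʳ (∼-sym p)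
  ∼-sym (padʳ p)   = padˡ (∼-sym p)

  ∼-trans : ∀ {l m n} → l ∼ m → m ∼ n → l ∼ n
  ∼-trans nil        q           = q
  ∼-trans (cons x p) (cons .x q) = cons x (∼-trans p q)
  ∼-trans (cons x p) (padˡ q)    = padˡ (∼-trans p q)
  ∼-trans (padˡ p)   nil         = padˡ p
  ∼-trans (padˡ p)   (padʳ q)    = cons d (∼-trans p q)
  ∼-trans (padʳ p)   (cons _ q)  = padʳ (∼-trans p q)
  ∼-trans (padʳ p)   (padˡ q)    = ∼-trans p q

  ∼-∷ʳ : ∀ {l l'} → l ∼ l' → l ∼ (l' ++ d ∷ [])
  ∼-∷ʳ nil        = padʳ nil
  ∼-∷ʳ (cons x p) = cons x (∼-∷ʳ p)
  ∼-∷ʳ (padˡ p)   = cons d p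
  ∼-∷ʳ (padʳ p)   = padʳ (∼-∷ʳ p)

  ∼-++ˡ : ∀ p {l l'} → l ∼ l' → (p ++ l) ∼ (p ++ l')
  ∼-++ˡ []      q = q
  ∼-++ˡ (x ∷ p) q = cons x (∼-++ˡ p q)

  ∼-hd∷tl : ∀ l → l ∼ (hd l ∷ tl l)
  ∼-hd∷tl []      = padʳ nil
  ∼-hd∷tl (x ∷ l) = ∼-refl _

  replicate-∼[] : ∀ n → replicate n d ∼ []
  replicate-∼[] zero    = nil
  replicate-∼[] (suc n) = padˡ (replicate-∼[] n)

  replicate-∼-d∷ : ∀ n → replicate n d ∼ (d ∷ replicate (Data.Nat.pred n) d)
  replicate-∼-d∷ zero    = padʳ nil
  replicate-∼-d∷ (suc n) = ∼-refl _

  move-hd-tl : ∀ dir T → move d dir T ≡ (case dir of λ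
    { L → tape (tl (left T)) (hd (left T)) (cur T ∷ right T)
    ; R → tape (cur T ∷ left T) (hd (right T)) (tl (right T)) })
  move-hd-tl L (tape [] c r)      = refl
  move-hd-tl L (tape (x ∷ l) c r) = refl
  move-hd-tl R (tape l c [])      = refl
  move-hd-tl R (tape l c (x ∷ r)) = refl

  record _≃_ (T T' : Tape A) : Set where
    constructor mk≃
    field
      ≃l : left T ∼ left T'
      ≃c : cur T ≡ cur T'
      ≃r : right T ∼ right T'
  open _≃_ public

  ≃-refl : ∀ T → T ≃ T
  ≃-refl T = mk≃ (∼-refl _) refl (∼-refl _)

  ≃-trans : ∀ {T T' T''} → T ≃ T' → T' ≃ T'' → T ≃ T''
  ≃-trans (mk≃ a b c) (mk≃ a' b' c') = mk≃ (∼-trans a a') (trans b b') (∼-trans c c')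

  ≃-move : ∀ {T T'} dir → T ≃ T' → move d dir T ≃ move d dir T'
  ≃-move {T} {T'} L (mk≃ a b c) rewrite move-hd-tl L T | move-hd-tl L T' =
    mk≃ (∼-tl a) (∼-hd a) (subst (λ z → (cur T ∷ right T) ∼ (z ∷ right T')) b (cons _ c))
  ≃-move {T} {T'} R (mk≃ a b c) rewrite move-hd-tl R T | move-hd-tl R T' =
    mk≃ (subst (λ z → (cur T ∷ left T) ∼ (z ∷ left T')) b (cons _ a)) (∼-hd c) (∼-tl c)

  ≃-writeCur : ∀ {T T'} a → T ≃ T' → writeCur a T ≃ writeCur a T'
  ≃-writeCur a (mk≃ x _ z) = mk≃ x refl z

  moveR∘moveL-≃ : ∀ T → move d R (move d L T) ≃ T
  moveR∘moveL-≃ (tape [] c r)      = mk≃ (padˡ nil) refl (∼-refl r)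
  moveR∘moveL-≃ (tape (x ∷ l) c r) = ≃-refl _

  -- T ≈ C , D : the tape reads C (left to right) before the head and D from the head on.
  record _≈_,_ (T : Tape A) (C D : List A) : Set where
    constructor mk≈
    field
      ≈l : left T ∼ reverse C
      ≈c : cur T ≡ hd D
      ≈r : right T ∼ tl D
  open _≈_,_ public

  ≈-resp : ∀ {T X X' C C'} → T ≈ X , C → reverse X ∼ reverse X' → C ∼ C' → T ≈ X' , C'
  ≈-resp (mk≈ l c r) x y = mk≈ (∼-trans l x) (trans c (∼-hd y)) (∼-trans r (∼-tl y))

  ≈-writeMoveR : ∀ {T C c D} a → T ≈ C , (c ∷ D) → move d R (writeCur a T) ≈ (C ++ a ∷ []) , D
  ≈-writeMoveR {tape l x []} {C} a (mk≈ p q r) =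
    mk≈ (subst (a ∷ l ∼_) (sym (reverse-++ C (a ∷ []))) (cons a p)) (∼-hd r) (∼-tl r)
  ≈-writeMoveR {tape l x (y ∷ rs)} {C} a (mk≈ p q r) =
    mk≈ (subst (a ∷ l ∼_) (sym (reverse-++ C (a ∷ []))) (cons a p)) (∼-hd r) (∼-tl r)

  ≈-writeMoveL : ∀ {T C x c D} a → T ≈ (C ++ x ∷ []) , (c ∷ D) → move d L (writeCur a T) ≈ C , (x ∷ a ∷ D)
  ≈-writeMoveL {tape [] y r} {C} {x} a (mk≈ p q s) =
    let p' = subst ([] ∼_) (reverse-++ C (x ∷ [])) p in mk≈ (∼-tl p') (∼-hd p') (cons a s)
  ≈-writeMoveL {tape (z ∷ l) y r} {C} {x} a (mk≈ p q s) =
    let p' = subst (z ∷ l ∼_) (reverse-++ C (x ∷ [])) p in mk≈ (∼-tl p') (∼-hd p') (cons a s)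

  ≈-moveR : ∀ {T C c D} → T ≈ C , (c ∷ D) → move d R T ≈ (C ++ c ∷ []) , D
  ≈-moveR {tape l x r} p@(mk≈ _ refl _) = ≈-writeMoveR x p

module Deterministic {C : Set} (S : C → C → Set) (det : ∀ {a b c} → S a b → S a c → b ≡ c) where

  steps : ∀ {a b} → Star S a b → ℕ
  steps ε       = 0
  steps (_ ◅ r) = suc (steps r)

  Terminal : C → Set
  Terminal h = ∀ x → S h x → ⊥

  remainingRun : ∀ {a h b} (r : Star S a h) → Terminal h → (p : Star S a b) →
                 Σ (Star S b h) λ r' → steps r' + steps p ≡ steps r
  remainingRun r       th ε       = r , Data.Nat.Properties.+-identityʳ _
  remainingRun ε       th (s ◅ p) = ⊥-elim (th _ s)
  remainingRun (s' ◅ r) th (s ◅ p) with det s s'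
  ... | refl with remainingRun r th p
  ... | r' , e = r' , trans (+-suc (steps r') (steps p)) (cong suc e)

  terminal-unique : ∀ {a h h'} → Star S a h → Terminal h → Star S a h' → Terminal h' → h ≡ h'
  terminal-unique r th r' th' with remainingRun r th r'
  ... | ε     , _ = refl
  ... | s ◅ _ , _ = ⊥-elim (th' _ s)

record Finite (A : Set) : Set where
  field
    size          : ℕ
    toFin         : A → Fin size
    fromFin       : Fin size → A
    fromFin-toFin : ∀ a → fromFin (toFin a) ≡ a
open Finite public

retractFinite : {A B : Set} (f : A → B) (g : B → A) → (∀ a → g (f a) ≡ a) → Finite B → Finite A
retractFinite f g gf FB = record
  { size = size FB ; toFin = toFin FB ∘ f ; fromFin = g ∘ fromFin FB
  ; fromFin-toFin = λ a → trans (cong g (fromFin-toFin FB (f a))) (gf a) }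

instance
  Fin-finite : ∀ {n} → Finite (Fin n)
  Fin-finite {n} = record { size = n ; toFin = id ; fromFin = id ; fromFin-toFin = λ _ → refl }

  ⊤-finite : Finite ⊤
  ⊤-finite = record { size = 1 ; toFin = λ _ → zero ; fromFin = λ _ → tt ; fromFin-toFin = λ _ → refl }

  ⊎-finite : ∀ {A B} → {{Finite A}} → {{Finite B}} → Finite (A ⊎ B)
  ⊎-finite {A} {B} {{FA}} {{FB}} = record { size = size FA + size FB ; toFin = to ; fromFin = from ; fromFin-toFin = inverse }
    where
    to : A ⊎ B → Fin (size FA + size FB)
    to (inj₁ a) = toFin FA a ↑ˡ size FB
    to (inj₂ b) = size FA ↑ʳ toFin FB b
    from : Fin (size FA + size FB) → A ⊎ B
    from = Data.Sum.map (fromFin FA) (fromFin FB) ∘ splitAt (size FA)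
    inverse : ∀ x → from (to x) ≡ x
    inverse (inj₁ a) rewrite splitAt-↑ˡ (size FA) (toFin FA a) (size FB) = cong inj₁ (fromFin-toFin FA a)
    inverse (inj₂ b) rewrite splitAt-↑ʳ (size FA) (size FB) (toFin FB b) = cong inj₂ (fromFin-toFin FB b)

  ×-finite : ∀ {A B} → {{Finite A}} → {{Finite B}} → Finite (A × B)
  ×-finite {A} {B} {{FA}} {{FB}} = record
    { size = size FA * size FB ; toFin = λ (a , b) → combine (toFin FA a) (toFin FB b)
    ; fromFin = Data.Product.map (fromFin FA) (fromFin FB) ∘ remQuot (size FB)
    ; fromFin-toFin = λ (a , b) → trans (cong (Data.Product.map (fromFin FA) (fromFin FB)) (remQuot-combine (toFin FA a) (toFin FB b)))
                                        (cong₂ _,_ (fromFin-toFin FA a) (fromFin-toFin FB b)) }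

  Vec-finite : ∀ {A n} → {{Finite A}} → Finite (Vec A n)
  Vec-finite {n = zero}  = retractFinite (λ _ → tt) (λ _ → []) (λ { [] → refl }) ⊤-finite
  Vec-finite {n = suc n} = retractFinite (λ { (x ∷ xs) → x , xs }) (λ (x , xs) → x ∷ xs) (λ { (x ∷ xs) → refl })
                                         (×-finite {{it}} {{Vec-finite}})

  Bool-finite : Finite Bool
  Bool-finite = retractFinite (λ { false → inj₁ tt ; true → inj₂ tt }) (λ { (inj₁ _) → false ; (inj₂ _) → true })
                              (λ { false → refl ; true → refl }) it

  Γ-finite : Finite Γ
  Γ-finite = retractFinite (λ { 𝟘 → inj₁ tt ; 𝟙 → inj₂ (inj₁ tt) ; □ → inj₂ (inj₂ tt) })
                           (λ { (inj₁ _) → 𝟘 ; (inj₂ (inj₁ _)) → 𝟙 ; (inj₂ (inj₂ _)) → □ }) (λ { 𝟘 → refl ; 𝟙 → refl ; □ → refl })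
                           (⊎-finite {⊤} {⊤ ⊎ ⊤})

  Dir-finite : Finite Dir
  Dir-finite = retractFinite (λ { L → false ; R → true }) (if_then R else L) (λ { L → refl ; R → refl }) it

mapTape : ∀ {A B : Set} → (A → B) → Tape A → Tape B
mapTape f (tape l c r) = tape (map f l) (f c) (map f r)

mapTape-move : ∀ {A B : Set} (f : A → B) (dA : A) dir T → mapTape f (move dA dir T) ≡ move (f dA) dir (mapTape f T)
mapTape-move f dA L (tape [] c r)      = refl
mapTape-move f dA L (tape (x ∷ l) c r) = refl
mapTape-move f dA R (tape l c [])      = refl
mapTape-move f dA R (tape l c (x ∷ r)) = refl

mapTape-writeCur : ∀ {A B : Set} (f : A → B) a T → mapTape f (writeCur a T) ≡ writeCur (f a) (mapTape f T)
mapTape-writeCur f a (tape l c r) = refl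

TStep-deterministic : ∀ M {a b c} → TStep M a b → TStep M a c → b ≡ c
TStep-deterministic M (t-step _ e) (t-step _ e') with trans (sym e) e'
... | refl = refl

SStep-deterministic : ∀ {s} (M : STM s) {a b c} → SStep M a b → SStep M a c → b ≡ c
SStep-deterministic M (δ-step _ i e) (δ-step _ i' e') with trans (sym i) i'
... | refl with trans (sym e) e'
... | refl = refl
SStep-deterministic M (γ-step _ i) (γ-step _ i') with trans (sym i) i'
... | refl = refl
SStep-deterministic M (η-step _ i e) (η-step _ i' e') with trans (sym i) i'
... | refl with trans (sym e) e'
... | refl = refl
SStep-deterministic M (δ-step _ i _) (γ-step _ i')   with () ← trans (sym i) i'
SStep-deterministic M (δ-step _ i _) (η-step _ i' _) with () ← trans (sym i) i'
SStep-deterministic M (γ-step _ i)   (δ-step _ i' _) with () ← trans (sym i) i'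
SStep-deterministic M (γ-step _ i)   (η-step _ i' _) with () ← trans (sym i) i'
SStep-deterministic M (η-step _ i _) (δ-step _ i' _) with () ← trans (sym i) i'
SStep-deterministic M (η-step _ i _) (γ-step _ i')   with () ← trans (sym i) i'

All-reverse : ∀ {A : Set} {P : A → Set} xs → All P xs → All P (reverse xs)
All-reverse []       []       = []
All-reverse {P = P} (x ∷ xs) (p ∷ ps) = subst (All P) (sym (unfold-reverse x xs)) (++⁺ (All-reverse xs ps) (p ∷ []))

toList-injective′ : ∀ {A : Set} {n} (xs ys : Vec A n) → toList xs ≡ toList ys → xs ≡ ys
toList-injective′ xs ys e = trans (sym (cast-is-id refl xs)) (toList-injective refl xs ys e)

splitLast : ∀ {A : Set} (l : List A) n → length l ≡ suc n → Σ (List A) λ l' → Σ A λ x → (l ≡ l' ++ x ∷ []) × (length l' ≡ n)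
splitLast [] n ()
splitLast (x ∷ []) zero e = [] , x , refl , refl
splitLast (x ∷ []) (suc n) ()
splitLast (x ∷ y ∷ l) zero ()
splitLast (x ∷ y ∷ l) (suc n) e with splitLast (y ∷ l) n (suc-injective e)
... | l' , z , e1 , e2 = x ∷ l' , z , cong (x ∷_) e1 , cong suc e2

take-++ : ∀ {A : Set} m {n} (xs : Vec A m) (ys : Vec A n) → Vec.take m (xs Vec.++ ys) ≡ xs
take-++ m xs ys = ++-injectiveˡ _ xs (take++drop≡id m (xs Vec.++ ys))

drop-++ : ∀ {A : Set} m {n} (xs : Vec A m) (ys : Vec A n) → Vec.drop m (xs Vec.++ ys) ≡ ys
drop-++ m xs ys = ++-injectiveʳ _ xs (take++drop≡id m (xs Vec.++ ys))

bitCell : Bool → Cell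
bitCell b = just (bit b)

bit-injective : ∀ {a b} → bit a ≡ bit b → a ≡ b
bit-injective {false} {false} _ = refl
bit-injective {true}  {true}  _ = refl

bitCell-injective : ∀ {a b} → bitCell a ≡ bitCell b → a ≡ b
bitCell-injective {false} {false} _ = refl
bitCell-injective {true}  {true}  _ = refl

outputCells : List Bool → List Cell
outputCells v = reverse (map bitCell v)

reverse-outputCells : ∀ v → reverse (outputCells v ++ []) ≡ map bitCell v
reverse-outputCells v = trans (cong reverse (++-identityʳ (outputCells v))) (reverse-involutive (map bitCell v))

outputCells-injective : ∀ {o ob v} → o ≡ outputCells ob → reverse o ≡ map bitCell v → ob ≡ v
outputCells-injective {ob = ob} refl oc = map-injective bitCell-injective (trans (sym (reverse-involutive (map bitCell ob))) oc)

IsBitCell : Cell → Set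
IsBitCell x = Σ Bool λ b → x ≡ bitCell b

AllBitCells : List Cell → Set
AllBitCells = All IsBitCell

reverse-AllBitCells : ∀ {o v} → reverse o ≡ map bitCell v → AllBitCells o
reverse-AllBitCells {o} {v} oc =
  subst AllBitCells (trans (cong reverse (sym oc)) (reverse-involutive o)) (All-reverse (map bitCell v) (bitCells v))
  where
  bitCells : ∀ v → AllBitCells (map bitCell v)
  bitCells []      = []
  bitCells (b ∷ v) = (b , refl) ∷ bitCells v

bit≢□ : ∀ b → bit b ≢ □
bit≢□ false ()
bit≢□ true  ()

ReadsWord-functional : ∀ {M T v v'} → ReadsWord M T v → ReadsWord M T v' → v ≡ v'
ReadsWord-functional (rw-end e)    (rw-end e')     = refl
ReadsWord-functional (rw-end e)    (rw-cons e' r') = ⊥-elim (bit≢□ _ (trans (sym e') e))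
ReadsWord-functional (rw-cons e r) (rw-end e')     = ⊥-elim (bit≢□ _ (trans (sym e) e'))
ReadsWord-functional (rw-cons e r) (rw-cons e' r') = cong₂ _∷_ (bit-injective (trans (sym e) e')) (ReadsWord-functional r r')

-- Simulating a Turing machine by a step Turing machine

module SimulateTM (s : ℕ) (M : TM) where
  open TM M using () renaming (nQ to tnQ; q₀ to tq₀; final to tfinal; δ to tδ)
  open UpToPadding □

  State : Set
  State = Fin 8 ⊎ Fin tnQ

  pattern ReadInput  = inj₁ 0F
  pattern StepRight  = inj₁ 1F
  pattern Rewind     = inj₁ 2F
  pattern Check      = inj₁ 3F
  pattern StepBack   = inj₁ 4F
  pattern Emit       = inj₁ 5F
  pattern NextOutput = inj₁ 6F
  pattern Halt       = inj₁ 7F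
  pattern Simulate q = inj₂ q

  code : State → Fin (size (it {A = Finite State}))
  code = toFin it

  Column : Set
  Column = Vec Cell 1

  symbol : Column → Γ
  symbol (nothing ∷ []) = □
  symbol (just a ∷ []) = a

  column : Γ → Column
  column a = just a ∷ []

  noActions : SCP s
  noActions _ = 0

  Move : Set
  Move = Maybe (SCP s × Column × Dir × Fin (size (it {A = Finite State})))

  afterRead : Γ → State
  afterRead □ = Rewind
  afterRead _ = StepRight

  rewind : Column → Move
  rewind (nothing ∷ []) = just (noActions , nothing ∷ [] , R , code (Simulate tq₀))
  rewind (just a ∷ [])  = just (noActions , just a ∷ [] , L , code Rewind)

  simulate′ : Maybe (Fin tnQ × Γ × Dir) → Move
  simulate′ nothing              = nothing
  simulate′ (just (q' , a , d)) = just (noActions , column a , d , code (Simulate q'))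

  simulate : Fin tnQ → Column → Move
  simulate q col = simulate′ (tδ q (symbol col))

  check′ : Column → Γ → Move
  check′ col □ = just (noActions , col , R , code Halt)
  check′ col _ = just (noActions , col , L , code StepBack)

  check : Column → Move
  check col = check′ col (symbol col)

  stepTo : Dir → State → Instr s 1 _
  stepTo d q = stepη (λ col → just (noActions , col , d , code q))

  simulateOrCheck : Fin tnQ → Bool → Instr s 1 _
  simulateOrCheck q true  = stepη check
  simulateOrCheck q false = stepη (simulate q)

  -- An η-step always moves, so a bit is emitted after stepping off its cell and back.
  instruction : State → Instr s 1 _
  instruction ReadInput    = readIn (λ a → zero , code (afterRead a))
  instruction StepRight    = stepTo R ReadInput
  instruction Rewind       = stepη rewind
  instruction (Simulate q) = simulateOrCheck q (tfinal q)
  instruction Check        = stepη check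
  instruction StepBack     = stepTo R Emit
  instruction Emit         = writeOut zero (code NextOutput)
  instruction NextOutput   = stepTo R Check
  instruction Halt         = writeOut zero (code Halt)

  isHalt : State → Bool
  isHalt Halt = true
  isHalt _    = false

  stm : STM s
  stm = record { k = 1 ; nQ = _ ; q₀ = code ReadInput ; final = isHalt ∘ fromFin it ; instr = instruction ∘ fromFin it }

  instr-code : ∀ x → STM.instr stm (code x) ≡ instruction x
  instr-code x = cong instruction (fromFin-toFin it x)

  final-code : ∀ x → STM.final stm (code x) ≡ isHalt x
  final-code x = cong isHalt (fromFin-toFin it x)

  Step = SStep stm

  Represents : Tape Column → Tape Γ → Set
  Represents P T = mapTape symbol P ≃ T

  readInput : ∀ w Ls → Star Step (sconf (code ReadInput) w (tape (map column Ls) (nothing ∷ []) []) [])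
                                 (sconf (code Rewind) [] (tape (map column (map bit w ʳ++ Ls)) (column □) []) [])
  readInput [] Ls = δ-step (final-code ReadInput) (instr-code ReadInput) refl ◅ ε
  readInput (b ∷ w) Ls =
    δ-step (final-code ReadInput) (instr-code ReadInput) (cong (λ x → zero , code x) (afterRead-bit b)) ◅
    η-step (final-code StepRight) (instr-code StepRight) refl ◅ readInput w (bit b ∷ Ls)
    where
    afterRead-bit : ∀ b → afterRead (bit b) ≡ StepRight
    afterRead-bit false = refl
    afterRead-bit true  = refl

  atOrigin : List Column → Tape Column
  atOrigin []      = tape ((nothing ∷ []) ∷ []) (nothing ∷ []) []
  atOrigin (c ∷ r) = tape ((nothing ∷ []) ∷ []) c r

  rewindLoop : ∀ xs a Rs → Star Step (sconf (code Rewind) [] (tape (map column xs) (column a) Rs) [])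
                                     (sconf (code (Simulate tq₀)) [] (atOrigin (map column xs ʳ++ (column a ∷ Rs))) [])
  rewindLoop []       a Rs = η-step (final-code Rewind) (instr-code Rewind) refl ◅
                             η-step (final-code Rewind) (instr-code Rewind) refl ◅ ε
  rewindLoop (x ∷ xs) a Rs = η-step (final-code Rewind) (instr-code Rewind) refl ◅ rewindLoop xs x (column a ∷ Rs)

  map-symbol-ʳ++ : ∀ xs ys → map symbol (map column xs ʳ++ ys) ≡ xs ʳ++ map symbol ys
  map-symbol-ʳ++ []       ys = refl
  map-symbol-ʳ++ (x ∷ xs) ys = map-symbol-ʳ++ xs (column x ∷ ys)

  atOrigin-represents : ∀ w Z → map symbol Z ≡ map bit w ++ □ ∷ [] → Represents (atOrigin Z) (inputTape M w)
  atOrigin-represents [] (z ∷ Z) e with ∷-injective e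
  ... | e1 , e2 = mk≃ (padˡ nil) e1 (subst (_∼ []) (sym e2) nil)
  atOrigin-represents (b ∷ w) (z ∷ Z) e with ∷-injective e
  ... | e1 , e2 = mk≃ (padˡ nil) e1 (subst (_∼ map bit w) (sym e2) (∼-sym (∼-∷ʳ (∼-refl _))))

  initialise : ∀ w → Σ (Tape Column) λ P → Star Step (sinit stm w) (sconf (code (Simulate tq₀)) [] P []) × Represents P (inputTape M w)
  initialise w = atOrigin Z , (readInput w [] ◅◅ rewindLoop (map bit w ʳ++ []) □ []) , atOrigin-represents w Z eq
    where
    Z = map column (map bit w ʳ++ []) ʳ++ (column □ ∷ [])
    eq : map symbol Z ≡ map bit w ++ □ ∷ []
    eq = begin
      map symbol Z                                    ≡⟨ map-symbol-ʳ++ (map bit w ʳ++ []) (column □ ∷ []) ⟩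
      (map bit w ʳ++ []) ʳ++ (□ ∷ [])                 ≡⟨ ʳ++-defn (map bit w ʳ++ []) ⟩
      reverse (map bit w ʳ++ []) ++ □ ∷ []            ≡⟨ cong (λ z → reverse z ++ □ ∷ []) (ʳ++-defn (map bit w)) ⟩
      reverse (reverse (map bit w) ++ []) ++ □ ∷ []   ≡⟨ cong (λ z → reverse z ++ □ ∷ []) (++-identityʳ (reverse (map bit w))) ⟩
      reverse (reverse (map bit w)) ++ □ ∷ []         ≡⟨ cong (_++ □ ∷ []) (reverse-involutive _) ⟩
      map bit w ++ □ ∷ []                             ∎
      where open ≡-Reasoning

  represents-writeMove : ∀ {P T} dir c → Represents P T →
                         Represents (move (nothing ∷ []) dir (writeCur c P)) (move □ dir (writeCur (symbol c) T))
  represents-writeMove {P} {T} dir c r =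
    subst (_≃ move □ dir (writeCur (symbol c) T))
      (sym (trans (mapTape-move symbol _ dir (writeCur c P)) (cong (move □ dir) (mapTape-writeCur symbol c P))))
      (≃-move dir (≃-writeCur (symbol c) r))

  represents-move : ∀ {P T} dir → Represents P T → Represents (move (nothing ∷ []) dir P) (move □ dir T)
  represents-move {P} {T} dir r =
    subst (λ z → Represents (move _ dir P) (move □ dir (writeCur z T))) (≃c r) (represents-writeMove {P} {T} dir (cur P) r)

  instr-simulate : ∀ q → tfinal q ≡ false → STM.instr stm (code (Simulate q)) ≡ stepη (simulate q)
  instr-simulate q fq = trans (instr-code (Simulate q)) (cong (simulateOrCheck q) fq)

  simulateStep : ∀ {q T q' T'} P → TStep M (tconf q T) (tconf q' T') → Represents P T →
                 Σ (Tape Column) λ P' → Step (sconf (code (Simulate q)) [] P []) (sconf (code (Simulate q')) [] P' [])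
                                       × Represents P' T'
  simulateStep {q} {T} P (t-step {a = a} {d = d} fq e) r =
    move (nothing ∷ []) d (writeCur (column a) P) ,
    η-step (final-code (Simulate q)) (instr-simulate q fq) (trans (cong (simulate′ ∘ tδ q) (≃c r)) (cong simulate′ e)) ,
    represents-writeMove {P} {T} d (column a) r

  simulateStuck : ∀ {q T} P → tfinal q ≡ false → tδ q (cur T) ≡ nothing → Represents P T →
                  ∀ c → Step (sconf (code (Simulate q)) [] P []) c → ⊥
  simulateStuck {q} P fq e r c (δ-step _ i _) with () ← trans (sym i) (instr-simulate q fq)
  simulateStuck {q} P fq e r c (γ-step _ i)   with () ← trans (sym i) (instr-simulate q fq)
  simulateStuck {q} P fq e r c (η-step _ i e') with trans (sym i) (instr-simulate q fq)
  ... | refl with () ← trans (sym e') (trans (cong (simulate′ ∘ tδ q) (≃c r)) (cong simulate′ e))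

  check-blank : ∀ c → symbol c ≡ □ → check c ≡ just (noActions , c , R , code Halt)
  check-blank (nothing ∷ []) e = refl
  check-blank (just □ ∷ []) e = refl

  check-bit : ∀ c b → symbol c ≡ bit b → (check c ≡ just (noActions , c , L , code StepBack)) × (lookup c zero ≡ bitCell b)
  check-bit (just 𝟘 ∷ []) false e = refl , refl
  check-bit (just 𝟙 ∷ []) true  e = refl , refl
  check-bit (nothing ∷ []) false ()
  check-bit (nothing ∷ []) true  ()
  check-bit (just 𝟙 ∷ []) false ()
  check-bit (just □ ∷ []) false ()
  check-bit (just 𝟘 ∷ []) true  ()
  check-bit (just □ ∷ []) true  ()

  outputCells-∷ : ∀ b v o → outputCells v ++ (bitCell b ∷ o) ≡ outputCells (b ∷ v) ++ o
  outputCells-∷ b v o = trans (sym (++-assoc (outputCells v) (bitCell b ∷ []) o))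
                              (cong (_++ o) (sym (unfold-reverse (bitCell b) (map bitCell v))))

  copyOutput : ∀ x → instruction x ≡ stepη check → isHalt x ≡ false → ∀ {T v} → ReadsWord M T v → ∀ P o → Represents P T →
               Σ (Tape Column) λ P' → Star Step (sconf (code x) [] P o) (sconf (code Halt) [] P' (outputCells v ++ o))
  copyOutput x ix fx (rw-end e) P o r =
    _ , η-step (trans (final-code x) fx) (trans (instr-code x) ix) (check-blank (cur P) (trans (≃c r) e)) ◅ ε
  copyOutput x ix fx {T} {b ∷ v} (rw-cons e rw) P o r with check-bit (cur P) b (trans (≃c r) e)
  ... | checked , lk =
    proj₁ rest ,
    η-step (trans (final-code x) fx) (trans (instr-code x) ix) checked ◅
    η-step (final-code StepBack) (instr-code StepBack) refl ◅
    subst (λ z → Step (sconf (code Emit) [] P₂ o) (sconf (code NextOutput) [] P₂ (z ∷ o))) lk₂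
          (γ-step (final-code Emit) (instr-code Emit)) ◅
    η-step (final-code NextOutput) (instr-code NextOutput) refl ◅
    subst (λ z → Star Step (sconf (code Check) [] P₃ (bitCell b ∷ o)) (sconf (code Halt) [] (proj₁ rest) z))
          (outputCells-∷ b v o) (proj₂ rest)
    where
    P₁ = move (nothing ∷ []) L (writeCur (cur P) P)
    P₂ = move (nothing ∷ []) R (writeCur (cur P₁) P₁)
    P₃ = move (nothing ∷ []) R (writeCur (cur P₂) P₂)
    r₂ : Represents P₂ T
    r₂ = subst (_≃ T) (sym (trans (mapTape-move symbol _ R (move _ L P)) (cong (move □ R) (mapTape-move symbol _ L P))))
               (≃-trans (moveR∘moveL-≃ (mapTape symbol P)) r)
    rest = copyOutput Check refl refl rw P₃ (bitCell b ∷ o) (represents-move R r₂)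
    lk₂ : lookup (cur P₂) zero ≡ bitCell b
    lk₂ = trans (cong (λ z → lookup z zero) (UpToPadding._≃_.≃c (UpToPadding.moveR∘moveL-≃ _ P))) lk

  simulateRun : ∀ {q T c'} → Star (TStep M) (tconf q T) c' → ∀ P → Represents P T →
                Σ (Tape Column) λ P' → Star Step (sconf (code (Simulate q)) [] P []) (sconf (code (Simulate (TConf.state c'))) [] P' [])
                                      × Represents P' (TConf.tp c')
  simulateRun ε P r = P , ε , r
  simulateRun (t-step fq e ◅ rest) P r with simulateStep P (t-step fq e) r
  ... | P₁ , s₁ , r₁ with simulateRun rest P₁ r₁
  ... | P₂ , s₂ , r₂ = P₂ , s₁ ◅ s₂ , r₂

  tm⇒stm : ∀ w v → TMOutputs M w v → STMOutputs stm w v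
  tm⇒stm w v (tconf qh Th , run , fin , rw) with initialise w
  ... | P₀ , init , r₀ with simulateRun run P₀ r₀
  ... | P₁ , sim , r₁ with copyOutput (Simulate qh) (cong (simulateOrCheck qh) fin) refl rw P₁ [] r₁
  ... | P₂ , out = sconf (code Halt) [] P₂ (outputCells v ++ []) , (init ◅◅ sim ◅◅ out) , final-code Halt ,
                   reverse-outputCells v

  open Deterministic Step (SStep-deterministic stm)

  final-terminal : ∀ c → STM.final stm (SConf.state c) ≡ true → Terminal c
  final-terminal (sconf q w P o) f x (δ-step f' _ _) with () ← trans (sym f) f'
  final-terminal (sconf q w P o) f x (γ-step f' _)   with () ← trans (sym f) f'
  final-terminal (sconf q w P o) f x (η-step f' _ _) with () ← trans (sym f) f'

  readsWord : ∀ T → ∃ (ReadsWord M T)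
  readsWord (tape l c r) = readsFrom l c r
    where
    readsFrom : ∀ l c r → ∃ (ReadsWord M (tape l c r))
    readsFrom l □ r       = [] , rw-end refl
    readsFrom l 𝟘 []      = false ∷ [] , rw-cons {b = false} refl (rw-end refl)
    readsFrom l 𝟙 []      = true ∷ [] , rw-cons {b = true} refl (rw-end refl)
    readsFrom l 𝟘 (x ∷ r) = Data.Product.map (false ∷_) (rw-cons {b = false} refl) (readsFrom (𝟘 ∷ l) x r)
    readsFrom l 𝟙 (x ∷ r) = Data.Product.map (true ∷_) (rw-cons {b = true} refl) (readsFrom (𝟙 ∷ l) x r)

  -- Induction on the length of the run of stm, which by determinism passes through the simulation of each step of M.
  reflectRun : ∀ v n {q T P c} → (r : Star Step (sconf (code (Simulate q)) [] P []) c) → steps r < n →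
               STM.final stm (SConf.state c) ≡ true → reverse (SConf.output c) ≡ map bitCell v → Represents P T →
               ∃ λ c' → Star (TStep M) (tconf q T) c' × tfinal (TConf.state c') ≡ true × ReadsWord M (TConf.tp c') v
  reflectRun v (suc n) {q} {T} {P} {c} r lt fc oc rel with tfinal q in fq
  ... | true with readsWord T
  ... | v' , rw' with copyOutput (Simulate q) (cong (simulateOrCheck q) fq) refl rw' P [] rel
  ... | P' , out with terminal-unique r (final-terminal c fc) out (final-terminal _ (final-code Halt))
  ... | refl = tconf q T , ε , fq ,
               subst (ReadsWord M T) (map-injective bitCell-injective
                                        (trans (sym (reverse-outputCells v')) oc)) rw'
  reflectRun v (suc n) {q} {T} {P} {c} r lt fc oc rel | false with tδ q (cur T) in eδ
  ... | nothing with terminal-unique r (final-terminal c fc) ε (simulateStuck P fq eδ rel)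
  ... | refl with () ← trans (sym fc) (final-code (Simulate q))
  reflectRun v (suc n) {q} {T} {P} {c} r (s≤s lt) fc oc rel | false | just (q' , a , d) with simulateStep P (t-step fq eδ) rel
  ... | P' , s₁ , r₁ with remainingRun r (final-terminal c fc) (s₁ ◅ ε)
  ... | r' , e with reflectRun v n r' (subst (_≤ n) (sym (trans (+-comm 1 (steps r')) e)) lt) fc oc r₁
  ... | c' , run , f , rw = c' , t-step fq eδ ◅ run , f , rw

  stm⇒tm : ∀ w v → STMOutputs stm w v → TMOutputs M w v
  stm⇒tm w v (c , run , fc , oc) with initialise w
  ... | P₀ , init , r₀ with remainingRun run (final-terminal c fc) init
  ... | r' , _ = reflectRun v (suc (steps r')) r' ≤-refl fc oc r₀

  outputs⇔ : ∀ w v → STMOutputs stm w v ⇔ TMOutputs M w v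
  outputs⇔ w v = mk⇔ (stm⇒tm w v) (tm⇒stm w v)

-- Simulating a step Turing machine by a Turing machine

double : ℕ → ℕ
double zero = zero
double (suc n) = suc (suc (double n))

cellBit : Γ → Bool
cellBit 𝟙 = true
cellBit _ = false

isBlank : Γ → Bool
isBlank □ = true
isBlank _ = false

cellCode : Cell → Bool × Bool
cellCode nothing = false , false
cellCode (just 𝟘) = false , true
cellCode (just 𝟙) = true , false
cellCode (just □) = true , true

decodeCell : Bool → Bool → Cell
decodeCell false false = nothing
decodeCell false true = just 𝟘
decodeCell true false = just 𝟙
decodeCell true true = just □

encodeColumn : ∀ {n} → Vec Cell n → Vec Bool (double n)
encodeColumn [] = []
encodeColumn (x ∷ xs) = proj₁ (cellCode x) ∷ proj₂ (cellCode x) ∷ encodeColumn xs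

decodeColumn : ∀ n → Vec Bool (double n) → Vec Cell n
decodeColumn zero [] = []
decodeColumn (suc n) (a ∷ b ∷ r) = decodeCell a b ∷ decodeColumn n r

data IsBit : Γ → Set where
  b0 : IsBit 𝟘
  b1 : IsBit 𝟙

bit-IsBit : ∀ b → IsBit (bit b)
bit-IsBit false = b0
bit-IsBit true = b1

map-bit-IsBit : ∀ l → All IsBit (map bit l)
map-bit-IsBit [] = []
map-bit-IsBit (b ∷ l) = bit-IsBit b ∷ map-bit-IsBit l

blanks-□ : ∀ bs C → All (_≡ □) bs → Σ (List Γ) λ C₁ → bs ++ □ ∷ C ≡ □ ∷ C₁
blanks-□ [] C [] = C , refl
blanks-□ (b ∷ bs) C (refl ∷ ps) = bs ++ □ ∷ C , refl

decodeCell-cellCode : ∀ x → decodeCell (proj₁ (cellCode x)) (proj₂ (cellCode x)) ≡ x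
decodeCell-cellCode nothing = refl
decodeCell-cellCode (just 𝟘) = refl
decodeCell-cellCode (just 𝟙) = refl
decodeCell-cellCode (just □) = refl

decodeColumn-encodeColumn : ∀ n (v : Vec Cell n) → decodeColumn n (encodeColumn v) ≡ v
decodeColumn-encodeColumn zero [] = refl
decodeColumn-encodeColumn (suc n) (x ∷ v) = cong₂ _∷_ (decodeCell-cellCode x) (decodeColumn-encodeColumn n v)

encodeColumn-empty : ∀ n → encodeColumn (Vec.replicate n nothing) ≡ Vec.replicate (double n) false
encodeColumn-empty zero = refl
encodeColumn-empty (suc n) = cong (λ z → false ∷ false ∷ z) (encodeColumn-empty n)

map-cellBit-bit : ∀ l → map cellBit (map bit l) ≡ l
map-cellBit-bit [] = refl
map-cellBit-bit (false ∷ l) = cong (false ∷_) (map-cellBit-bit l)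
map-cellBit-bit (true ∷ l) = cong (true ∷_) (map-cellBit-bit l)

inputOutput : List Bool → List Bool → List Γ
inputOutput [] ob = map bit ob
inputOutput (x ∷ w) ob = map bit (x ∷ w) ++ □ ∷ map bit ob

rightRegion : ℕ → List Bool → List Bool → List Γ
rightRegion g w ob = □ ∷ replicate g □ ++ inputOutput w ob

module SimulateSTM {s : ℕ} (M : STM s) where
  open UpToPadding □

  open STM M renaming (k to kk; nQ to sQ; q₀ to sq₀; final to sfinal; instr to sinstr)

  D : ℕ
  D = double kk + double kk

  B : ℕ
  B = suc (suc (suc D))

  Column : Set
  Column = Vec Cell kk

  Block : Set
  Block = Vec Bool B

  emptyColumn : Column
  emptyColumn = Vec.replicate kk nothing

  block : Bool → Bool → Bool → Column → Column → Block
  block hd h z cu cl = hd ∷ h ∷ z ∷ (encodeColumn cu Vec.++ encodeColumn cl)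

  isHead track isOrigin : Block → Bool
  isHead (hd ∷ h ∷ z ∷ r) = hd
  track (hd ∷ h ∷ z ∷ r) = h
  isOrigin (hd ∷ h ∷ z ∷ r) = z

  upper lower : Block → Column
  upper (hd ∷ h ∷ z ∷ r) = decodeColumn kk (Vec.take (double kk) r)
  lower (hd ∷ h ∷ z ∷ r) = decodeColumn kk (Vec.drop (double kk) r)

  top : Fin B
  top = fromℕ (suc (suc D))

  top∸1 : Fin B
  top∸1 = inject₁ (fromℕ (suc D))

  zeros : Block
  zeros = Vec.replicate B false

  shiftIn : ∀ {n} → Vec Bool (suc n) → Bool → Vec Bool (suc n)
  shiftIn (x ∷ xs) b = xs Vec.∷ʳ b

  -- Control data is kept in sums of finite types, named by pattern synonyms, so that the
  -- finiteness of the state space is found by instance search. A tag says what to do with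
  -- the next block read; ex and oe record that the input is exhausted and that some output
  -- has been written, which fixes the shape of the trips to the right end of the tape.
  Tag : Set
  Tag = Fin sQ × Bool × Bool ⊎ Bool × Fin sQ × Bool × Bool ⊎ Fin kk × Γ × Fin sQ × Bool × Bool ⊎ Bool

  pattern tExecute q ex oe = inj₁ (q , ex , oe)
  pattern tMark h q ex oe = inj₂ (inj₁ (h , q , ex , oe))
  pattern tPut i a q ex oe = inj₂ (inj₂ (inj₁ (i , a , q , ex , oe)))
  pattern tInit ex = inj₂ (inj₂ (inj₂ ex))

  Mode : Set
  Mode = Fin sQ × Bool ⊎ Bool × Tag × Bool × Bool ⊎ Bool × Bool

  pattern mIn q oe = inj₁ (q , oe)
  pattern mOut b t ex oe = inj₂ (inj₁ (b , t , ex , oe))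
  pattern mHalt ex oe = inj₂ (inj₂ (ex , oe))

  Next : Set
  Next = Tag ⊎ Tag ⊎ Tag ⊎ Mode

  pattern nRead t = inj₁ t
  pattern nHopLeft t = inj₂ (inj₁ t)
  pattern nHopRight t = inj₂ (inj₂ (inj₁ t))
  pattern nTrip m = inj₂ (inj₂ (inj₂ m))

  CycleState : Set
  CycleState = Tag × Fin B × Block ⊎ Block × Fin B × Next ⊎ Block × Fin B × Next ⊎ Fin B × Next ⊎ Fin B × Tag ⊎ Fin B × Tag

  ReturnState : Set
  ReturnState = Tag ⊎ Tag ⊎ Fin B × Tag ⊎ Tag ⊎ Tag

  InputState : Set
  InputState = Mode ⊎ Fin sQ × Bool ⊎ Bool × Fin sQ × Bool

  OutputState : Set
  OutputState = Bool × Tag ⊎ Bool × Tag ⊎ Bool × Tag ⊎ Bool × Bool × Tag ⊎ Bool × Tag ⊎ Tag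

  ControlState : Set
  ControlState = ⊤ ⊎ Bool ⊎ ⊤ ⊎ Dir ⊎ ⊤ ⊎ ⊤

  State : Set
  State = CycleState ⊎ ReturnState ⊎ InputState ⊎ OutputState ⊎ ControlState

  pattern inCycle x = inj₁ x
  pattern inReturn x = inj₂ (inj₁ x)
  pattern inInputTrip x = inj₂ (inj₂ (inj₁ x))
  pattern inOutputTrip x = inj₂ (inj₂ (inj₂ (inj₁ x)))
  pattern inControl x = inj₂ (inj₂ (inj₂ (inj₂ x)))

  pattern Read t c acc = inCycle (inj₁ (t , c , acc))
  pattern BackToWrite buf c nx = inCycle (inj₂ (inj₁ (buf , c , nx)))
  pattern Write buf c nx = inCycle (inj₂ (inj₂ (inj₁ (buf , c , nx))))
  pattern BackAfterWrite c nx = inCycle (inj₂ (inj₂ (inj₂ (inj₁ (c , nx)))))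
  pattern HopLeft c t = inCycle (inj₂ (inj₂ (inj₂ (inj₂ (inj₁ (c , t))))))
  pattern HopRight c t = inCycle (inj₂ (inj₂ (inj₂ (inj₂ (inj₂ (c , t))))))
  pattern ReturnLeft t = inReturn (inj₁ t)
  pattern ReturnStep t = inReturn (inj₂ (inj₁ t))
  pattern SkipBlock c t = inReturn (inj₂ (inj₂ (inj₁ (c , t))))
  pattern CheckMarker t = inReturn (inj₂ (inj₂ (inj₂ (inj₁ t))))
  pattern EnterBlock t = inReturn (inj₂ (inj₂ (inj₂ (inj₂ t))))
  pattern GoRight m = inInputTrip (inj₁ m)
  pattern SkipGapToInput q oe = inInputTrip (inj₂ (inj₁ (q , oe)))
  pattern PeekInput b q oe = inInputTrip (inj₂ (inj₂ (b , q , oe)))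
  pattern SkipGapBeforeInput b t = inOutputTrip (inj₁ (b , t))
  pattern SkipInput b t = inOutputTrip (inj₂ (inj₁ (b , t)))
  pattern SkipGapBeforeOutput b t = inOutputTrip (inj₂ (inj₂ (inj₁ (b , t))))
  pattern ToOutputEnd b ex t = inOutputTrip (inj₂ (inj₂ (inj₂ (inj₁ (b , ex , t)))))
  pattern BackOverOutput ex t = inOutputTrip (inj₂ (inj₂ (inj₂ (inj₂ (inj₁ (ex , t))))))
  pattern BackOverInput t = inOutputTrip (inj₂ (inj₂ (inj₂ (inj₂ (inj₂ t)))))
  pattern Init = inControl (inj₁ tt)
  pattern HaltSkipGap ex = inControl (inj₂ (inj₁ ex))
  pattern HaltSkipInput = inControl (inj₂ (inj₂ (inj₁ tt)))
  pattern HaltAlign d = inControl (inj₂ (inj₂ (inj₂ (inj₁ d))))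
  pattern Stop = inControl (inj₂ (inj₂ (inj₂ (inj₂ (inj₁ tt)))))
  pattern Dead = inControl (inj₂ (inj₂ (inj₂ (inj₂ (inj₂ tt)))))

  abstract
    State-finite : Finite State
    State-finite = it

  headColumn : Block → Column
  headColumn b = if track b then lower b else upper b

  setHeadColumn : Block → Column → Block
  setHeadColumn b col = if track b then block (isHead b) (track b) (isOrigin b) (upper b) col else block (isHead b) (track b) (isOrigin b) col (lower b)

  Action : Set
  Action = Maybe (Block × Next)

  moveAction : Block → Column → Dir → Fin sQ → Bool → Bool → Action
  moveAction b col' d q' ex oe with track b | d | isOrigin b
  ... | false | R | z = just (block false false z col' (lower b) , nHopLeft (tMark false q' ex oe))
  ... | false | L | true = just (block true true true col' (lower b) , nRead (tExecute q' ex oe))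
  ... | false | L | false = just (block false false false col' (lower b) , nHopRight (tMark false q' ex oe))
  ... | true | L | z = just (block false false z (upper b) col' , nHopLeft (tMark true q' ex oe))
  ... | true | R | true = just (block true false true (upper b) col' , nRead (tExecute q' ex oe))
  ... | true | R | false = just (block false false false (upper b) col' , nHopRight (tMark true q' ex oe))

  outputAction : Block → Cell → Fin sQ → Bool → Bool → Action
  outputAction b (just 𝟘) q' ex oe = just (b , nTrip (mOut false (tExecute q' ex true) ex oe))
  outputAction b (just 𝟙) q' ex oe = just (b , nTrip (mOut true (tExecute q' ex true) ex oe))
  outputAction b _ q' ex oe = nothing

  ηAction : Block → Maybe (SCP s × Column × Dir × Fin sQ) → Bool → Bool → Action
  ηAction b nothing ex oe = nothing
  ηAction b (just (U , col' , d , q')) ex oe = moveAction b col' d q' ex oe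

  instrAction : Block → Fin sQ → Instr s kk sQ → Bool → Bool → Action
  instrAction b q (readIn f) true oe = just (setHeadColumn b (headColumn b [ proj₁ (f □) ]≔ just □) , nRead (tExecute (proj₂ (f □)) true oe))
  instrAction b q (readIn f) false oe = just (b , nTrip (mIn q oe))
  instrAction b q (writeOut i q') ex oe = outputAction b (lookup (headColumn b) i) q' ex oe
  instrAction b q (stepη g) ex oe = ηAction b (g (headColumn b)) ex oe

  execAction : Block → Fin sQ → Bool → Bool → Bool → Action
  execAction b q true ex oe = just (b , nTrip (mHalt ex oe))
  execAction b q false ex oe = instrAction b q (sinstr q) ex oe

  action : Tag → Block → Action
  action (tExecute q ex oe) b = execAction b q (sfinal q) ex oe
  action (tMark h' q ex oe) b = just (block true h' (isOrigin b) (upper b) (lower b) , nRead (tExecute q ex oe))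
  action (tPut i a q ex oe) b = just (setHeadColumn b (headColumn b [ i ]≔ just a) , nRead (tExecute q ex oe))
  action (tInit ex) b = just (block true false true emptyColumn emptyColumn , nRead (tExecute sq₀ ex false))

  -- An undefined action (M is stuck, or outputs a non-bit) leaves the simulator stuck in Dead.
  afterRead : Tag → Block → State
  afterRead t b with action t b
  ... | nothing = Dead
  ... | just (buf , nx) = BackToWrite buf top nx

  start : Next → State
  start (nRead t) = Read t top zeros
  start (nHopLeft t) = HopLeft top t
  start (nHopRight t) = HopRight top t
  start (nTrip m) = GoRight m

  inputTag′ : Instr s kk sQ → Fin sQ → Bool → Bool → Bool → Tag
  inputTag′ (readIn f) q b ex oe = tPut (proj₁ (f (bit b))) (bit b) (proj₂ (f (bit b))) ex oe
  inputTag′ _ q b ex oe = tExecute q ex oe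

  inputTag : Fin sQ → Bool → Bool → Bool → Tag
  inputTag q b ex oe = inputTag′ (sinstr q) q b ex oe

  countdown : (Fin B → State) → State → Fin B → State
  countdown S F zero    = F
  countdown S F (suc c) = S (inject₁ c)

  tripAction : Mode → Maybe (State × Γ × Dir)
  tripAction (mIn q oe) = just (SkipGapToInput q oe , □ , R)
  tripAction (mOut b t false oe) = just (SkipGapBeforeInput b t , □ , R)
  tripAction (mOut b t true true) = just (SkipGapBeforeOutput b t , □ , R)
  tripAction (mOut b t true false) = just (ToOutputEnd b true t , □ , R)
  tripAction (mHalt ex false) = just (HaltAlign L , □ , R)
  tripAction (mHalt ex true) = just (HaltSkipGap ex , □ , R)

  Transition : Set
  Transition = Maybe (State × Γ × Dir)

  transition : State → Γ → Transition
  transition Init x = just (HopLeft top (tInit (isBlank x)) , x , L)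
  transition (Read t c acc) x = just (countdown (λ c → Read t c (shiftIn acc (cellBit x))) (afterRead t (shiftIn acc (cellBit x))) c , x , R)
  transition (BackToWrite buf c nx) x = just (countdown (λ c → BackToWrite buf c nx) (Write buf top nx) c , x , L)
  transition (Write buf c nx) x = just (countdown (λ c → Write (shiftIn buf false) c nx) (BackAfterWrite top nx) c , bit (Vec.head buf) , R)
  transition (BackAfterWrite c nx) x = just (countdown (λ c → BackAfterWrite c nx) (start nx) c , x , L)
  transition (HopLeft c t) x = just (countdown (λ c → HopLeft c t) (Read t top zeros) c , x , L)
  transition (HopRight c t) x = just (countdown (λ c → HopRight c t) (Read t top zeros) c , x , R)
  transition (ReturnLeft t) □ = just (ReturnLeft t , □ , L)
  transition (ReturnLeft t) 𝟘 = just (ReturnStep t , 𝟘 , R)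
  transition (ReturnLeft t) 𝟙 = just (ReturnStep t , 𝟙 , R)
  transition (ReturnStep t) x = just (SkipBlock top∸1 t , x , L)
  transition (SkipBlock c t) x = just (countdown (λ c → SkipBlock c t) (CheckMarker t) c , x , L)
  transition (CheckMarker t) 𝟙 = just (EnterBlock t , 𝟙 , R)
  transition (CheckMarker t) 𝟘 = just (SkipBlock top∸1 t , 𝟘 , L)
  transition (CheckMarker t) □ = nothing
  transition (EnterBlock t) x = just (Read t top zeros , x , L)
  transition (GoRight m) 𝟘 = just (GoRight m , 𝟘 , R)
  transition (GoRight m) 𝟙 = just (GoRight m , 𝟙 , R)
  transition (GoRight m) □ = tripAction m
  transition (SkipGapToInput q oe) □ = just (SkipGapToInput q oe , □ , R)
  transition (SkipGapToInput q oe) 𝟘 = just (PeekInput false q oe , □ , R)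
  transition (SkipGapToInput q oe) 𝟙 = just (PeekInput true q oe , □ , R)
  transition (PeekInput b q oe) x = just (ReturnLeft (inputTag q b (isBlank x) oe) , x , L)
  transition (SkipGapBeforeInput b t) □ = just (SkipGapBeforeInput b t , □ , R)
  transition (SkipGapBeforeInput b t) 𝟘 = just (SkipInput b t , 𝟘 , R)
  transition (SkipGapBeforeInput b t) 𝟙 = just (SkipInput b t , 𝟙 , R)
  transition (SkipInput b t) □ = just (ToOutputEnd b false t , □ , R)
  transition (SkipInput b t) 𝟘 = just (SkipInput b t , 𝟘 , R)
  transition (SkipInput b t) 𝟙 = just (SkipInput b t , 𝟙 , R)
  transition (SkipGapBeforeOutput b t) □ = just (SkipGapBeforeOutput b t , □ , R)
  transition (SkipGapBeforeOutput b t) 𝟘 = just (ToOutputEnd b true t , 𝟘 , R)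
  transition (SkipGapBeforeOutput b t) 𝟙 = just (ToOutputEnd b true t , 𝟙 , R)
  transition (ToOutputEnd b ex t) □ = just (BackOverOutput ex t , bit b , L)
  transition (ToOutputEnd b ex t) 𝟘 = just (ToOutputEnd b ex t , 𝟘 , R)
  transition (ToOutputEnd b ex t) 𝟙 = just (ToOutputEnd b ex t , 𝟙 , R)
  transition (BackOverOutput true t) □ = just (ReturnLeft t , □ , L)
  transition (BackOverOutput false t) □ = just (BackOverInput t , □ , L)
  transition (BackOverOutput ex t) 𝟘 = just (BackOverOutput ex t , 𝟘 , L)
  transition (BackOverOutput ex t) 𝟙 = just (BackOverOutput ex t , 𝟙 , L)
  transition (BackOverInput t) □ = just (ReturnLeft t , □ , L)
  transition (BackOverInput t) 𝟘 = just (BackOverInput t , 𝟘 , L)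
  transition (BackOverInput t) 𝟙 = just (BackOverInput t , 𝟙 , L)
  transition (HaltSkipGap ex) □ = just (HaltSkipGap ex , □ , R)
  transition (HaltSkipGap true) 𝟘 = just (HaltAlign R , 𝟘 , L)
  transition (HaltSkipGap true) 𝟙 = just (HaltAlign R , 𝟙 , L)
  transition (HaltSkipGap false) 𝟘 = just (HaltSkipInput , 𝟘 , R)
  transition (HaltSkipGap false) 𝟙 = just (HaltSkipInput , 𝟙 , R)
  transition HaltSkipInput □ = just (Stop , □ , R)
  transition HaltSkipInput 𝟘 = just (HaltSkipInput , 𝟘 , R)
  transition HaltSkipInput 𝟙 = just (HaltSkipInput , 𝟙 , R)
  transition (HaltAlign d) x = just (Stop , x , d)
  transition Stop x = nothing
  transition Dead x = nothing

  isFinal : State → Bool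
  isFinal Stop = true
  isFinal _ = false

  nStates : ℕ
  nStates = size State-finite

  code : State → Fin nStates
  code = toFin State-finite

  codeTransition : Transition → Maybe (Fin nStates × Γ × Dir)
  codeTransition nothing = nothing
  codeTransition (just (q , a , d)) = just (code q , a , d)

  tm : TM
  tm = record { nQ = nStates ; q₀ = code Init ; final = isFinal ∘ fromFin State-finite
              ; δ = λ i a → codeTransition (transition (fromFin State-finite i) a) }

  module Col = UpToPadding emptyColumn
  open Col using () renaming (_∼_ to _∼E_; hd to hdE; tl to tlE)

  Step = TStep tm

  config : State → Tape Γ → TConf tm
  config q T = tconf (code q) T

  Plus : TConf tm → TConf tm → Set
  Plus a b = Σ (TConf tm) λ m → Step a m × Star Step m b

  Reach : State → List Γ → List Γ → State → List Γ → List Γ → Set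
  Reach q X C q' X' C' = ∀ T → T ≈ X , C → Σ (Tape Γ) λ T' → Star Step (config q T) (config q' T') × T' ≈ X' , C'

  Reach⁺ : State → List Γ → List Γ → State → List Γ → List Γ → Set
  Reach⁺ q X C q' X' C' = ∀ T → T ≈ X , C → Σ (Tape Γ) λ T' → Plus (config q T) (config q' T') × T' ≈ X' , C'

  starPlus : ∀ {a b c} → Star Step a b → Plus b c → Plus a c
  starPlus ε p = p
  starPlus (s1 ◅ r1) (m , s2 , r2) = _ , s1 , r1 ◅◅ (s2 ◅ r2)

  infixr 5 _⊙_ _⊙⁺_ _⁺⊙_
  _⊙_ : ∀ {a X C b Y D c Z E} → Reach a X C b Y D → Reach b Y D c Z E → Reach a X C c Z E
  (f ⊙ g) T p with f T p
  ... | T1 , r1 , p1 with g T1 p1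
  ... | T2 , r2 , p2 = T2 , r1 ◅◅ r2 , p2

  _⁺⊙_ : ∀ {a X C b Y D c Z E} → Reach⁺ a X C b Y D → Reach b Y D c Z E → Reach⁺ a X C c Z E
  (f ⁺⊙ g) T p with f T p
  ... | T1 , (m , s1 , r1) , p1 with g T1 p1
  ... | T2 , r2 , p2 = T2 , (m , s1 , r1 ◅◅ r2) , p2

  _⊙⁺_ : ∀ {a X C b Y D c Z E} → Reach a X C b Y D → Reach⁺ b Y D c Z E → Reach⁺ a X C c Z E
  (f ⊙⁺ g) T p with f T p
  ... | T1 , r1 , p1 with g T1 p1
  ... | T2 , pl , p2 = T2 , starPlus r1 pl , p2

  weaken : ∀ {a X C b Y D} → Reach⁺ a X C b Y D → Reach a X C b Y D
  weaken f T p with f T p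
  ... | T1 , (m , s1 , r1) , p1 = T1 , s1 ◅ r1 , p1

  stay : ∀ {a X C} → Reach a X C a X C
  stay T p = T , ε , p

  reachCong : ∀ {a X C b Y D Y' D'} → Y ≡ Y' → D ≡ D' → Reach a X C b Y D → Reach a X C b Y' D'
  reachCong refl refl f = f

  reachCong⁺ : ∀ {a X C b Y D Y' D'} → Y ≡ Y' → D ≡ D' → Reach⁺ a X C b Y D → Reach⁺ a X C b Y' D'
  reachCong⁺ refl refl f = f

  reachCongL : ∀ {a X C X' C' b Y D} → X ≡ X' → C ≡ C' → Reach a X' C' b Y D → Reach a X C b Y D
  reachCongL refl refl f = f

  reachCongL⁺ : ∀ {a X C X' C' b Y D} → X ≡ X' → C ≡ C' → Reach⁺ a X' C' b Y D → Reach⁺ a X C b Y D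
  reachCongL⁺ refl refl f = f

  reachRespL⁺ : ∀ {a X C X' C' b Y D} → reverse X ∼ reverse X' → C ∼ C' → Reach⁺ a X' C' b Y D → Reach⁺ a X C b Y D
  reachRespL⁺ x c f T p = f T (≈-resp p x c)

  transitionStep : ∀ {q c q' a dir T} → isFinal q ≡ false → transition q c ≡ just (q' , a , dir) → cur T ≡ c →
          Step (config q T) (config q' (move □ dir (writeCur a T)))
  transitionStep {q} {c} {q'} {a} {dir} {T} f e ec =
    t-step (trans (cong isFinal (fromFin-toFin State-finite q)) f)
           (trans (cong (λ z → codeTransition (transition z (cur T))) (fromFin-toFin State-finite q)) (trans (cong (λ z → codeTransition (transition q z)) ec) (cong codeTransition e)))

  stepR : ∀ {q c q' a X C} → isFinal q ≡ false → transition q c ≡ just (q' , a , R) → Reach⁺ q X (c ∷ C) q' (X ++ a ∷ []) C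
  stepR {a = a} f e T p = _ , (_ , transitionStep f e (≈c p) , ε) , ≈-writeMoveR a p

  stepL : ∀ {q c q' a X x C} → isFinal q ≡ false → transition q c ≡ just (q' , a , L) → Reach⁺ q (X ++ x ∷ []) (c ∷ C) q' X (x ∷ a ∷ C)
  stepL {a = a} f e T p = _ , (_ , transitionStep f e (≈c p) , ε) , ≈-writeMoveL a p

  walkR : ∀ q (P : Γ → Set) → isFinal q ≡ false → (∀ a → P a → transition q a ≡ just (q , a , R)) →
          ∀ ys → All P ys → ∀ X C → Reach q X (ys ++ C) q (X ++ ys) C
  walkR q P f e [] [] X C = reachCong (sym (++-identityʳ X)) refl stay
  walkR q P f e (y ∷ ys) (py ∷ pys) X C =
    reachCong (++-assoc X (y ∷ []) ys) refl (weaken (stepR f (e y py)) ⊙ walkR q P f e ys pys (X ++ y ∷ []) C)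

  walkLr : ∀ q (P : Γ → Set) → isFinal q ≡ false → (∀ a → P a → transition q a ≡ just (q , a , L)) →
           ∀ rs → All P rs → ∀ X c C → P c → Reach q (X ++ reverse rs) (c ∷ C) q X (reverse rs ++ c ∷ C)
  walkLr q P f e [] [] X c C pc = reachCong refl refl (reachCongL (++-identityʳ X) refl stay)
  walkLr q P f e (r ∷ rs) (pr ∷ prs) X c C pc =
    reachCongL (trans (cong (X ++_) (unfold-reverse r rs)) (sym (++-assoc X (reverse rs) (r ∷ []))))
      refl
      (reachCong refl (sym (trans (cong (_++ c ∷ C) (unfold-reverse r rs)) (++-assoc (reverse rs) (r ∷ []) (c ∷ C))))
        (weaken (stepL f (e c pc)) ⊙ walkLr q P f e rs prs X r (c ∷ C) pr))

  walkL : ∀ q (P : Γ → Set) → isFinal q ≡ false → (∀ a → P a → transition q a ≡ just (q , a , L)) →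
          ∀ ys → All P ys → ∀ X c C → P c → Reach q (X ++ ys) (c ∷ C) q X (ys ++ c ∷ C)
  walkL q P f e ys pys X c C pc =
    subst (λ z → Reach q (X ++ z) (c ∷ C) q X (z ++ c ∷ C)) (reverse-involutive ys)
      (walkLr q P f e (reverse ys) (All-reverse ys pys) X c C pc)

  countLeft′ : (S : Fin B → State) (F : State) → (∀ c → isFinal (S c) ≡ false) →
             (∀ x → transition (S zero) x ≡ just (F , x , L)) →
             (∀ c x → transition (S (suc c)) x ≡ just (S (inject₁ c) , x , L)) →
             ∀ rs (c : Fin B) → suc (toℕ c) ≡ length rs → ∀ X c₀ C →
             Reach⁺ (S c) (X ++ reverse rs) (c₀ ∷ C) F X (reverse rs ++ c₀ ∷ C)
  countLeft′ S F fS e0 eS [] c () X c₀ C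
  countLeft′ S F fS e0 eS (r ∷ []) zero eq X c₀ C = stepL (fS zero) (e0 c₀)
  countLeft′ S F fS e0 eS (r ∷ r' ∷ rs) zero ()
  countLeft′ S F fS e0 eS (r ∷ []) (suc c) ()
  countLeft′ S F fS e0 eS (r ∷ r' ∷ rs) (suc c) eq X c₀ C =
    reachCongL⁺ (trans (cong (X ++_) (unfold-reverse r (r' ∷ rs))) (sym (++-assoc X (reverse (r' ∷ rs)) (r ∷ [])))) refl
      (reachCong⁺ refl (sym (trans (cong (_++ c₀ ∷ C) (unfold-reverse r (r' ∷ rs))) (++-assoc (reverse (r' ∷ rs)) (r ∷ []) (c₀ ∷ C))))
        (stepL (fS (suc c)) (eS c c₀) ⁺⊙
          weaken (countLeft′ S F fS e0 eS (r' ∷ rs) (inject₁ c) (trans (cong suc (toℕ-inject₁ c)) (suc-injective eq)) X r (c₀ ∷ C))))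

  countLeft : (S : Fin B → State) (F : State) → (∀ c → isFinal (S c) ≡ false) →
              (∀ x → transition (S zero) x ≡ just (F , x , L)) →
              (∀ c x → transition (S (suc c)) x ≡ just (S (inject₁ c) , x , L)) →
              ∀ ys (c : Fin B) → suc (toℕ c) ≡ length ys → ∀ X c₀ C →
              Reach⁺ (S c) (X ++ ys) (c₀ ∷ C) F X (ys ++ c₀ ∷ C)
  countLeft S F fS e0 eS ys c eq X c₀ C =
    subst (λ z → Reach⁺ (S c) (X ++ z) (c₀ ∷ C) F X (z ++ c₀ ∷ C)) (reverse-involutive ys)
      (countLeft′ S F fS e0 eS (reverse ys) c (trans eq (sym (length-reverse ys))) X c₀ C)

  countRight : (S : Fin B → State) (F : State) → (∀ c → isFinal (S c) ≡ false) →
              (∀ x → transition (S zero) x ≡ just (F , x , R)) →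
              (∀ c x → transition (S (suc c)) x ≡ just (S (inject₁ c) , x , R)) →
              ∀ ys (c : Fin B) → suc (toℕ c) ≡ length ys → ∀ X C →
              Reach⁺ (S c) X (ys ++ C) F (X ++ ys) C
  countRight S F fS e0 eS [] c () X C
  countRight S F fS e0 eS (y ∷ []) zero eq X C = stepR (fS zero) (e0 y)
  countRight S F fS e0 eS (y ∷ y' ∷ ys) zero ()
  countRight S F fS e0 eS (y ∷ []) (suc c) ()
  countRight S F fS e0 eS (y ∷ y' ∷ ys) (suc c) eq X C =
    reachCong⁺ (++-assoc X (y ∷ []) (y' ∷ ys)) refl
      (stepR (fS (suc c)) (eS c y) ⁺⊙
        weaken (countRight S F fS e0 eS (y' ∷ ys) (inject₁ c) (trans (cong suc (toℕ-inject₁ c)) (suc-injective eq)) (X ++ y ∷ []) C))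

  shiftInAll : Block → List Γ → Block
  shiftInAll acc [] = acc
  shiftInAll acc (y ∷ ys) = shiftInAll (shiftIn acc (cellBit y)) ys

  readBlock : ∀ t ys (c : Fin B) acc → suc (toℕ c) ≡ length ys → ∀ X C →
             Reach⁺ (Read t c acc) X (ys ++ C) (afterRead t (shiftInAll acc ys)) (X ++ ys) C
  readBlock t [] c acc () X C
  readBlock t (y ∷ []) zero acc eq X C = stepR refl refl
  readBlock t (y ∷ y' ∷ ys) zero acc ()
  readBlock t (y ∷ []) (suc c) acc ()
  readBlock t (y ∷ y' ∷ ys) (suc c) acc eq X C =
    reachCong⁺ (++-assoc X (y ∷ []) (y' ∷ ys)) refl
      (stepR refl refl ⁺⊙
        weaken (readBlock t (y' ∷ ys) (inject₁ c) (shiftIn acc (cellBit y)) (trans (cong suc (toℕ-inject₁ c)) (suc-injective eq)) (X ++ y ∷ []) C))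

  head-toList : ∀ {n} (v : Vec Bool (suc n)) {w ws} → toList v ≡ w ∷ ws → Vec.head v ≡ w
  head-toList (x ∷ v) refl = refl

  toList-shiftIn : ∀ {n} (v : Vec Bool (suc n)) b {w ws} → toList v ≡ w ∷ ws → toList (shiftIn v b) ≡ ws ++ b ∷ []
  toList-shiftIn (x ∷ v) b refl = toList-∷ʳ b v

  writeBlock : ∀ ws zs ys buf (c : Fin B) nx → toList buf ≡ ws ++ zs → suc (toℕ c) ≡ length ws →
              length ys ≡ length ws → ∀ X C →
              Reach⁺ (Write buf c nx) X (ys ++ C) (BackAfterWrite top nx) (X ++ map bit ws) C
  writeBlock [] zs ys buf c nx eb () ey X C
  writeBlock (w ∷ []) zs (y ∷ []) buf zero nx eb ec ey X C =
    stepR refl (cong (λ z → just (BackAfterWrite top nx , bit z , R)) (head-toList buf eb))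
  writeBlock (w ∷ []) zs (y ∷ []) buf (suc c) nx eb () ey X C
  writeBlock (w ∷ w' ∷ ws) zs (y ∷ y' ∷ ys) buf zero nx eb () ey X C
  writeBlock (w ∷ w' ∷ ws) zs (y ∷ y' ∷ ys) buf (suc c) nx eb ec ey X C =
    reachCong⁺ (++-assoc X (bit w ∷ []) (map bit (w' ∷ ws))) refl
      (stepR refl (cong (λ z → just (Write (shiftIn buf false) (inject₁ c) nx , bit z , R)) (head-toList buf eb)) ⁺⊙
        weaken (writeBlock (w' ∷ ws) (zs ++ false ∷ []) (y' ∷ ys) (shiftIn buf false) (inject₁ c) nx
                  (trans (toList-shiftIn buf false eb) (++-assoc (w' ∷ ws) zs (false ∷ [])))
                  (trans (cong suc (toℕ-inject₁ c)) (suc-injective ec)) (suc-injective ey) (X ++ bit w ∷ []) C))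
  writeBlock (w ∷ []) zs [] buf c nx eb ec () X C
  writeBlock (w ∷ []) zs (y ∷ y' ∷ ys) buf c nx eb ec () X C
  writeBlock (w ∷ w' ∷ ws) zs [] buf c nx eb ec () X C
  writeBlock (w ∷ w' ∷ ws) zs (y ∷ []) buf c nx eb ec () X C

  upper-block : ∀ hd h z u l → upper (block hd h z u l) ≡ u
  upper-block hd h z u l = trans (cong (decodeColumn kk) (take-++ (double kk) (encodeColumn u) (encodeColumn l))) (decodeColumn-encodeColumn kk u)

  lower-block : ∀ hd h z u l → lower (block hd h z u l) ≡ l
  lower-block hd h z u l = trans (cong (decodeColumn kk) (drop-++ (double kk) (encodeColumn u) (encodeColumn l))) (decodeColumn-encodeColumn kk l)

  toList-shiftInAll : ∀ ys acc ps qs → toList acc ≡ ps ++ qs → length ps ≡ length ys → toList (shiftInAll acc ys) ≡ qs ++ map cellBit ys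
  toList-shiftInAll [] acc [] qs e _ = trans e (sym (++-identityʳ qs))
  toList-shiftInAll (y ∷ ys) acc (p ∷ ps) qs e le =
    trans (toList-shiftInAll ys (shiftIn acc (cellBit y)) ps (qs ++ cellBit y ∷ []) (trans (toList-shiftIn acc (cellBit y) e) (++-assoc ps qs _)) (suc-injective le))
          (++-assoc qs (cellBit y ∷ []) (map cellBit ys))
  toList-shiftInAll [] acc (p ∷ ps) qs e ()
  toList-shiftInAll (y ∷ ys) acc [] qs e ()

  toList-shiftInAll-zeros : ∀ cs → length cs ≡ B → toList (shiftInAll zeros cs) ≡ map cellBit cs
  toList-shiftInAll-zeros cs lc = toList-shiftInAll cs zeros (toList zeros) [] (sym (++-identityʳ _)) (trans (length-toList zeros) (sym lc))

  length-blockCells : ∀ (v : Block) → length (map bit (toList v)) ≡ B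
  length-blockCells v = trans (length-map bit (toList v)) (length-toList v)

  shiftInAll-blockCells : ∀ (blk : Block) → shiftInAll zeros (map bit (toList blk)) ≡ blk
  shiftInAll-blockCells blk = toList-injective′ _ _ (trans (toList-shiftInAll-zeros (map bit (toList blk)) (length-blockCells blk)) (map-cellBit-bit (toList blk)))

  shiftInAll-blanks : shiftInAll zeros (replicate B □) ≡ block false false false emptyColumn emptyColumn
  shiftInAll-blanks = toList-injective′ _ _ (trans (toList-shiftInAll-zeros (replicate B □) (length-replicate B)) (trans (cellBit-blanks B) (sym blankBlock)))
    where
    cellBit-blanks : ∀ n → map cellBit (replicate n □) ≡ replicate n false
    cellBit-blanks zero = refl
    cellBit-blanks (suc n) = cong (false ∷_) (cellBit-blanks n)
    toList-falses : ∀ a b → toList (Vec.replicate a false Vec.++ Vec.replicate b false) ≡ replicate (a + b) false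
    toList-falses zero b = toList-replicate b false
    toList-falses (suc a) b = cong (false ∷_) (toList-falses a b)
    blankBlock : toList (block false false false emptyColumn emptyColumn) ≡ replicate B false
    blankBlock = trans (cong (λ z → toList (false ∷ false ∷ false ∷ (z Vec.++ z))) (encodeColumn-empty kk))
              (cong (λ z → false ∷ false ∷ false ∷ z) (toList-falses (double kk) (double kk)))

  afterRead-just : ∀ {t b buf nx} → action t b ≡ just (buf , nx) → afterRead t b ≡ BackToWrite buf top nx
  afterRead-just {t} {b} e rewrite e = refl

  respect : ∀ {q X C X' C'} → reverse X ∼ reverse X' → C ∼ C' → Reach q X C q X' C'
  respect x c T p = T , ε , ≈-resp p x c

  respectʳ : ∀ {q X C C'} → C ∼ C' → Reach q X C q X C'
  respectʳ {X = X} c T p = T , ε , ≈-resp p (∼-refl (reverse X)) c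

  suc-toℕ-top : suc (toℕ top) ≡ B
  suc-toℕ-top = cong suc (toℕ-fromℕ (suc (suc D)))

  updateBlock : ∀ t cs buf nx X C → length cs ≡ B → action t (shiftInAll zeros cs) ≡ just (buf , nx) →
           Reach⁺ (Read t top zeros) X (cs ++ C) (start nx) X (map bit (toList buf) ++ C)
  updateBlock t cs buf nx X C lc ea =
    subst (λ z → Reach⁺ (Read t top zeros) X (cs ++ C) z (X ++ cs) C) (afterRead-just {t} {shiftInAll zeros cs} ea)
          (readBlock t cs top zeros (trans suc-toℕ-top (sym lc)) X C)
    ⁺⊙ respectʳ (∼-hd∷tl C)
    ⊙ weaken (countLeft (λ c → BackToWrite buf c nx) (Write buf top nx) (λ _ → refl) (λ _ → refl) (λ _ _ → refl)
                        cs top (trans suc-toℕ-top (sym lc)) X (hd C) (tl C))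
    ⊙ weaken (writeBlock (toList buf) [] cs buf top nx (sym (++-identityʳ _)) (trans suc-toℕ-top (sym (length-toList buf)))
                        (trans lc (sym (length-toList buf))) X (hd C ∷ tl C))
    ⊙ weaken (countLeft (λ c → BackAfterWrite c nx) (start nx) (λ _ → refl) (λ _ → refl) (λ _ _ → refl)
                        (map bit (toList buf)) top (trans suc-toℕ-top (sym (length-blockCells buf))) X (hd C) (tl C))
    ⊙ respectʳ (∼-++ˡ (map bit (toList buf)) (∼-sym (∼-hd∷tl C)))

  ColumnPair : Set
  ColumnPair = Column × Column

  cells : Bool → Bool → Bool → ColumnPair → List Γ
  cells hd h z (u , l) = map bit (toList (block hd h z u l))

  plainCells : ColumnPair → List Γ
  plainCells = cells false false false

  leftCells : List ColumnPair → List Γ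
  leftCells [] = []
  leftCells (b ∷ lb) = leftCells lb ++ plainCells b

  rightCells : List ColumnPair → List Γ
  rightCells [] = []
  rightCells (b ∷ []) = cells false false true b
  rightCells (b ∷ b' ∷ rb) = plainCells b ++ rightCells (b' ∷ rb)

  headCells : Bool → List ColumnPair → ColumnPair → List Γ
  headCells h rb b = cells true h (null rb) b

  length-cells : ∀ hd h z b → length (cells hd h z b) ≡ B
  length-cells hd h z (u , l) = length-blockCells (block hd h z u l)

  cells-IsBit : ∀ hd h z b → All IsBit (cells hd h z b)
  cells-IsBit hd h z (u , l) = map-bit-IsBit (toList (block hd h z u l))

  leftCells-IsBit : ∀ lb → All IsBit (leftCells lb)
  leftCells-IsBit [] = []
  leftCells-IsBit (b ∷ lb) = ++⁺ (leftCells-IsBit lb) (cells-IsBit false false false b)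

  rightCells-IsBit : ∀ rb → All IsBit (rightCells rb)
  rightCells-IsBit [] = []
  rightCells-IsBit (b ∷ []) = cells-IsBit false false true b
  rightCells-IsBit (b ∷ b' ∷ rb) = ++⁺ (cells-IsBit false false false b) (rightCells-IsBit (b' ∷ rb))

  leftCells-++ : ∀ xs ys → leftCells (xs ++ ys) ≡ leftCells ys ++ leftCells xs
  leftCells-++ [] ys = sym (++-identityʳ (leftCells ys))
  leftCells-++ (x ∷ xs) ys = trans (cong (_++ plainCells x) (leftCells-++ xs ys)) (++-assoc (leftCells ys) (leftCells xs) (plainCells x))

  rightCells-∷ʳ : ∀ rb bz → rightCells (rb ++ bz ∷ []) ≡ leftCells (reverse rb) ++ cells false false true bz
  rightCells-∷ʳ [] bz = refl
  rightCells-∷ʳ (x ∷ []) bz = refl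
  rightCells-∷ʳ (x ∷ y ∷ r) bz =
    trans (cong (plainCells x ++_) (rightCells-∷ʳ (y ∷ r) bz))
      (trans (sym (++-assoc (plainCells x) (leftCells (reverse (y ∷ r))) _))
        (cong (_++ cells false false true bz)
          (sym (trans (cong leftCells (unfold-reverse x (y ∷ r))) (leftCells-++ (reverse (y ∷ r)) (x ∷ []))))))

  skipBlockLeft : ∀ q t a Y blk C → isFinal q ≡ false → transition q a ≡ just (SkipBlock top∸1 t , a , L) → length blk ≡ B →
         Reach⁺ q (Y ++ blk) (a ∷ C) (CheckMarker t) Y (blk ++ a ∷ C)
  skipBlockLeft q t a Y blk C f e lb with splitLast blk (suc (suc D)) lb
  ... | blk' , y , refl , lb' =
    reachCongL⁺ (sym (++-assoc Y blk' (y ∷ []))) refl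
      (reachCong⁺ refl (sym (++-assoc blk' (y ∷ []) (a ∷ C)))
        (stepL f e ⁺⊙ weaken (countLeft (λ c → SkipBlock c t) (CheckMarker t) (λ _ → refl) (λ _ → refl) (λ _ _ → refl)
                               blk' top∸1 (trans (cong suc (trans (toℕ-inject₁ (fromℕ (suc D))) (toℕ-fromℕ (suc D)))) (sym lb'))
                               Y y (a ∷ C))))

  enterBlock : ∀ t Y C → Reach⁺ (CheckMarker t) Y (𝟙 ∷ C) (Read t top zeros) Y (𝟙 ∷ C)
  enterBlock t Y C = stepR refl refl ⁺⊙ respectʳ (∼-hd∷tl C) ⊙ weaken (stepL refl refl) ⊙ respectʳ (cons 𝟙 (∼-sym (∼-hd∷tl C)))

  scanToHead : ∀ t Lft h' z' hb mids z cur Rgt →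
         Reach⁺ (CheckMarker t) (Lft ++ cells true h' z' hb ++ leftCells mids) (cells false false z cur ++ Rgt)
                (Read t top zeros) Lft (cells true h' z' hb ++ leftCells mids ++ cells false false z cur ++ Rgt)
  scanToHead t Lft h' z' hb [] z cur Rgt =
    reachCongL⁺ (cong (Lft ++_) (++-identityʳ (cells true h' z' hb))) refl
      (skipBlockLeft (CheckMarker t) t 𝟘 Lft (cells true h' z' hb) _ refl refl (length-cells true h' z' hb)
       ⁺⊙ weaken (enterBlock t Lft _))
  scanToHead t Lft h' z' hb (m ∷ ms) z cur Rgt =
    reachCongL⁺ beforeHead refl
      (reachCong⁺ refl fromHead
        (skipBlockLeft (CheckMarker t) t 𝟘 (Lft ++ H ++ leftCells ms) (plainCells m) _ refl refl (length-cells false false false m)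
         ⁺⊙ weaken (scanToHead t Lft h' z' hb ms false m (cells false false z cur ++ Rgt))))
    where
    H = cells true h' z' hb
    beforeHead : Lft ++ H ++ (leftCells ms ++ plainCells m) ≡ (Lft ++ H ++ leftCells ms) ++ plainCells m
    beforeHead = trans (cong (Lft ++_) (sym (++-assoc H (leftCells ms) (plainCells m)))) (sym (++-assoc Lft (H ++ leftCells ms) (plainCells m)))
    fromHead : H ++ leftCells ms ++ plainCells m ++ cells false false z cur ++ Rgt ≡ H ++ (leftCells ms ++ plainCells m) ++ cells false false z cur ++ Rgt
    fromHead = cong (H ++_) (sym (++-assoc (leftCells ms) (plainCells m) _))

  returnLeft-bit : ∀ t x → IsBit x → transition (ReturnLeft t) x ≡ just (ReturnStep t , x , R)
  returnLeft-bit t .𝟘 b0 = refl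
  returnLeft-bit t .𝟙 b1 = refl

  arriveAtBlocks : ∀ t Y blk0 C₁ → length blk0 ≡ B → All IsBit blk0 →
           Reach⁺ (ReturnLeft t) (Y ++ blk0) (□ ∷ C₁) (CheckMarker t) Y (blk0 ++ □ ∷ C₁)
  arriveAtBlocks t Y blk0 C₁ len pb with splitLast blk0 (suc (suc D)) len
  ... | blk0' , x , refl , lb' =
    reachCongL⁺ (sym (++-assoc Y blk0' (x ∷ []))) refl
      (stepL refl refl ⁺⊙ weaken (stepR refl (returnLeft-bit t x (proj₂ (∷ʳ⁻ pb))))
       ⊙ reachCongL (++-assoc Y blk0' (x ∷ [])) refl (weaken (skipBlockLeft (ReturnStep t) t □ Y (blk0' ++ x ∷ []) C₁ refl refl len)))

  returnToHead : ∀ t lb h rb hb bs C → All (_≡ □) bs →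
         Reach⁺ (ReturnLeft t) (leftCells lb ++ headCells h rb hb ++ rightCells rb ++ bs) (□ ∷ C)
                (Read t top zeros) (leftCells lb) (headCells h rb hb ++ rightCells rb ++ bs ++ □ ∷ C)
  returnToHead t lb h rb hb bs C pbs with blanks-□ bs C pbs
  ... | C₁ , eC =
    reachCongL beforeHead refl
      (walkL (ReturnLeft t) (_≡ □) refl (λ { .□ refl → refl }) bs pbs Reg □ C refl)
    ⊙⁺ reachCongL⁺ refl eC (reachCong⁺ refl (cong (λ z → H ++ rightCells rb ++ z) (sym eC)) (rest (initLast rb)))
    where
    H = headCells h rb hb
    Reg = leftCells lb ++ H ++ rightCells rb
    beforeHead : leftCells lb ++ H ++ rightCells rb ++ bs ≡ Reg ++ bs
    beforeHead = trans (cong (leftCells lb ++_) (sym (++-assoc H (rightCells rb) bs))) (sym (++-assoc (leftCells lb) (H ++ rightCells rb) bs))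
    rest : InitLast rb →
           Reach⁺ (ReturnLeft t) Reg (□ ∷ C₁) (Read t top zeros) (leftCells lb) (H ++ rightCells rb ++ □ ∷ C₁)
    rest [] =
      reachCongL⁺ (cong (leftCells lb ++_) (++-identityʳ H)) refl
        (arriveAtBlocks t (leftCells lb) H C₁ (length-cells true h true hb) (cells-IsBit true h true hb)
         ⁺⊙ weaken (enterBlock t (leftCells lb) _))
    rest (rb' ∷ʳ′ bz) =
      reachCongL⁺ beforeHead′ refl
        (reachCong⁺ refl fromHead
          (arriveAtBlocks t (leftCells lb ++ H ++ leftCells (reverse rb')) (cells false false true bz) C₁
                  (length-cells false false true bz) (cells-IsBit false false true bz)
           ⁺⊙ weaken (scanToHead t (leftCells lb) h (null (rb' ++ bz ∷ [])) hb (reverse rb') true bz (□ ∷ C₁))))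
      where
      Z = cells false false true bz
      beforeHead′ : leftCells lb ++ H ++ rightCells (rb' ++ bz ∷ []) ≡ (leftCells lb ++ H ++ leftCells (reverse rb')) ++ Z
      beforeHead′ = trans (cong (λ z → leftCells lb ++ H ++ z) (rightCells-∷ʳ rb' bz))
             (trans (cong (leftCells lb ++_) (sym (++-assoc H (leftCells (reverse rb')) Z)))
                    (sym (++-assoc (leftCells lb) (H ++ leftCells (reverse rb')) Z)))
      fromHead : H ++ leftCells (reverse rb') ++ Z ++ □ ∷ C₁ ≡ H ++ rightCells (rb' ++ bz ∷ []) ++ □ ∷ C₁
      fromHead = cong (H ++_) (trans (sym (++-assoc (leftCells (reverse rb')) Z (□ ∷ C₁)))
                               (cong (_++ □ ∷ C₁) (sym (rightCells-∷ʳ rb' bz))))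

  -- Counting blocks leftwards from the origin block at the right end, block i holds planar
  -- cell i in its upper column and cell −1−i in its lower one; h tells which column the head is in.
  Fold : Bool → Tape Column → List ColumnPair → ColumnPair → List ColumnPair → Set
  Fold false P lb (u , l) rb = (cur P ≡ u) × (left P ∼E (map proj₁ rb ++ reverse (map proj₂ rb) ++ l ∷ map proj₂ lb)) × (right P ∼E map proj₁ lb)
  Fold true P lb (u , l) rb = (cur P ≡ l) × (left P ∼E map proj₂ lb) × (right P ∼E (map proj₂ rb ++ reverse (map proj₁ rb) ++ u ∷ map proj₁ lb))

  record Represents (sc : SConf M) (ex oe : Bool) (T : Tape Γ) : Set where
    constructor represents
    field
      lb rb : List ColumnPair
      hb : ColumnPair
      h : Bool
      g : ℕ
      ob : List Bool
      fold : Fold h (SConf.planar sc) lb hb rb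
      eout : SConf.output sc ≡ outputCells ob
      eex : ex ≡ null (SConf.input sc)
      eoe : oe ≡ not (null ob)
      tp : T ≈ leftCells lb , (headCells h rb hb ++ rightCells rb ++ rightRegion g (SConf.input sc) ob)

  Execute : Fin sQ → Bool → Bool → State
  Execute q ex oe = Read (tExecute q ex oe) top zeros

  StepSimulated : SConf M → Bool → Bool → Tape Γ → SConf M → Set
  StepSimulated sc ex oe T sc' = Σ Bool λ ex' → Σ Bool λ oe' → Σ (Tape Γ) λ T' →
    Plus (config (Execute (SConf.state sc) ex oe) T) (config (Execute (SConf.state sc') ex' oe') T') × Represents sc' ex' oe' T'

  updateHeadBlock : ∀ t hd h z u l C buf nx X → action t (block hd h z u l) ≡ just (buf , nx) →
           Reach⁺ (Read t top zeros) X (cells hd h z (u , l) ++ C) (start nx) X (map bit (toList buf) ++ C)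
  updateHeadBlock t hd h z u l C buf nx X ea =
    updateBlock t (cells hd h z (u , l)) buf nx X C (length-cells hd h z (u , l))
           (subst (λ v → action t v ≡ just (buf , nx)) (sym (shiftInAll-blockCells (block hd h z u l))) ea)

  action-execute : ∀ {q} ex oe b → sfinal q ≡ false → action (tExecute q ex oe) b ≡ instrAction b q (sinstr q) ex oe
  action-execute {q} ex oe b fq = cong (λ z → execAction b q z ex oe) fq

  putCell : Bool → Fin kk → Cell → ColumnPair → ColumnPair
  putCell false i x (u , l) = (u [ i ]≔ x) , l
  putCell true i x (u , l) = u , (l [ i ]≔ x)

  put-cells : ∀ h z u l i x →
    map bit (toList (setHeadColumn (block true h z u l) (headColumn (block true h z u l) [ i ]≔ x))) ≡ cells true h z (putCell h i x (u , l))
  put-cells false z u l i x rewrite upper-block true false z u l | lower-block true false z u l = refl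
  put-cells true z u l i x rewrite upper-block true true z u l | lower-block true true z u l = refl

  Fold-put : ∀ h P lb u l rb i x → Fold h P lb (u , l) rb → Fold h (writeCur (cur P [ i ]≔ x) P) lb (putCell h i x (u , l)) rb
  Fold-put false P lb u l rb i x (ec , el , er) = cong (_[ i ]≔ x) ec , el , er
  Fold-put true P lb u l rb i x (ec , el , er) = cong (_[ i ]≔ x) ec , el , er

  putUpdate : ∀ t h rb u l i x nx X C →
           action t (block true h (null rb) u l) ≡ just (setHeadColumn (block true h (null rb) u l) (headColumn (block true h (null rb) u l) [ i ]≔ x) , nx) →
           Reach⁺ (Read t top zeros) X (headCells h rb (u , l) ++ C) (start nx) X (headCells h rb (putCell h i x (u , l)) ++ C)
  putUpdate t h rb u l i x nx X C ea =
    reachCong⁺ refl (cong (_++ C) (put-cells h (null rb) u l i x)) (updateHeadBlock t true h (null rb) u l C _ nx X ea)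

  simulate-readEnd : ∀ q P o f T oe → Represents (sconf q [] P o) true oe T → sfinal q ≡ false → sinstr q ≡ readIn f →
            StepSimulated (sconf q [] P o) true oe T (sconf (proj₂ (f □)) [] (writeCur (cur P [ proj₁ (f □) ]≔ just □) P) o)
  simulate-readEnd q P o f T oe (represents lb rb (u , l) h g ob fold eout eex eoe tp) fq iq =
    true , oe , proj₁ r , proj₁ (proj₂ r) ,
    represents lb rb (putCell h (proj₁ (f □)) (just □) (u , l)) h g ob (Fold-put h P lb u l rb (proj₁ (f □)) (just □) fold) eout refl eoe (proj₂ (proj₂ r))
    where
    r = putUpdate (tExecute q true oe) h rb u l (proj₁ (f □)) (just □) (nRead (tExecute (proj₂ (f □)) true oe)) (leftCells lb) (rightCells rb ++ rightRegion g [] ob)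
               (trans (action-execute true oe _ fq) (cong (λ z → instrAction (block true h (null rb) u l) q z true oe) iq)) T tp

  goRight-bit : ∀ m a → IsBit a → transition (GoRight m) a ≡ just (GoRight m , a , R)
  goRight-bit m .𝟘 b0 = refl
  goRight-bit m .𝟙 b1 = refl

  blank-stepR : ∀ q → transition q □ ≡ just (q , □ , R) → ∀ a → a ≡ □ → transition q a ≡ just (q , a , R)
  blank-stepR q e .□ refl = e

  gapIn-bit : ∀ q oe b → transition (SkipGapToInput q oe) (bit b) ≡ just (PeekInput b q oe , □ , R)
  gapIn-bit q oe false = refl
  gapIn-bit q oe true = refl

  replicate-□-∷ : ∀ g (Y : List Γ) → replicate g □ ++ □ ∷ Y ≡ □ ∷ replicate g □ ++ Y
  replicate-□-∷ zero Y = refl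
  replicate-□-∷ (suc g) Y = cong (□ ∷_) (replicate-□-∷ g Y)

  ++-assoc₄ : ∀ {A : Set} (a b c d : List A) → ((a ++ b ++ c) ++ d) ≡ a ++ b ++ c ++ d
  ++-assoc₄ a b c d = trans (++-assoc a (b ++ c) d) (cong (a ++_) (++-assoc b c d))

  fetchInputBit : ∀ q oe X Bs → All IsBit Bs → ∀ g b y Y →
    Reach (GoRight (mIn q oe)) X (Bs ++ □ ∷ replicate g □ ++ bit b ∷ y ∷ Y)
          (ReturnLeft (inputTag q b (isBlank y) oe)) (X ++ Bs ++ □ ∷ replicate g □) (□ ∷ y ∷ Y)
  fetchInputBit q oe X Bs bits g b y Y =
    walkR (GoRight (mIn q oe)) IsBit refl (goRight-bit _) Bs bits X _
    ⊙ weaken (stepR refl refl)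
    ⊙ walkR (SkipGapToInput q oe) (_≡ □) refl (blank-stepR (SkipGapToInput q oe) refl) (replicate g □) (replicate⁺ g refl) _ _
    ⊙ weaken (stepR refl (gapIn-bit q oe b))
    ⊙ weaken (stepL refl refl)
    ⊙ reachCongL (sym (trans (sym (++-assoc X Bs (□ ∷ replicate g □))) (sym (++-assoc (X ++ Bs) (□ ∷ []) (replicate g □))))) refl stay

  simulate-readBit′ : ∀ q b w' P o f T oe (y : Γ) (Yr : List Bool → List Γ) (g' : ℕ → ℕ) →
    Represents (sconf q (b ∷ w') P o) false oe T → sfinal q ≡ false → sinstr q ≡ readIn f →
    (∀ ob → map bit w' ++ □ ∷ map bit ob ≡ y ∷ Yr ob) → isBlank y ≡ null w' →
    (∀ g ob → □ ∷ replicate g □ ++ □ ∷ map bit w' ++ □ ∷ map bit ob ≡ rightRegion (g' g) w' ob) →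
    StepSimulated (sconf q (b ∷ w') P o) false oe T (sconf (proj₂ (f (bit b))) w' (writeCur (cur P [ proj₁ (f (bit b)) ]≔ just (bit b)) P) o)
  simulate-readBit′ q b w' P o f T oe y Yr g' (represents lb rb (u , l) h g ob fold eout eex eoe tp) fq iq eY eyb eg =
    isBlank y , oe , proj₁ r , proj₁ (proj₂ r) ,
    represents lb rb hb' h (g' g) ob (Fold-put h P lb u l rb i (just (bit b)) fold) eout eyb eoe (proj₂ (proj₂ r))
    where
    i = proj₁ (f (bit b))
    q' = proj₂ (f (bit b))
    hb' = putCell h i (just (bit b)) (u , l)
    H = headCells h rb (u , l)
    Rr = rightCells rb
    blk = block true h (null rb) u l
    t' = inputTag q b (isBlank y) oe
    bs = □ ∷ replicate g □
    Z = □ ∷ y ∷ Yr ob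
    trip : Reach⁺ (Execute q false oe) (leftCells lb) (H ++ Rr ++ rightRegion g (b ∷ w') ob) (GoRight (mIn q oe)) (leftCells lb) ((H ++ Rr) ++ bs ++ bit b ∷ y ∷ Yr ob)
    trip = reachCong⁺ refl (trans (sym (++-assoc H Rr _)) (cong (λ z → (H ++ Rr) ++ bs ++ bit b ∷ z) (eY ob)))
             (updateHeadBlock (tExecute q false oe) true h (null rb) u l (Rr ++ rightRegion g (b ∷ w') ob) blk (nTrip (mIn q oe)) (leftCells lb)
                (trans (action-execute false oe blk fq) (cong (λ z → instrAction blk q z false oe) iq)))
    back : Reach⁺ (ReturnLeft t') (leftCells lb ++ (H ++ Rr) ++ bs) Z (Execute q' (isBlank y) oe) (leftCells lb) (headCells h rb hb' ++ Rr ++ bs ++ Z)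
    back = reachCongL⁺ (cong (leftCells lb ++_) (++-assoc H Rr bs)) refl (returnToHead t' lb h rb (u , l) bs (y ∷ Yr ob) (replicate⁺ (suc g) refl))
           ⁺⊙ subst (λ z → Reach (Read z top zeros) (leftCells lb) (H ++ Rr ++ bs ++ Z) (Execute q' (isBlank y) oe) (leftCells lb) (headCells h rb hb' ++ Rr ++ bs ++ Z))
                    (cong (λ z → inputTag′ z q b (isBlank y) oe) (sym iq))
                    (weaken (putUpdate (tPut i (bit b) q' (isBlank y) oe) h rb u l i (just (bit b)) (nRead (tExecute q' (isBlank y) oe)) (leftCells lb) (Rr ++ bs ++ Z) refl))
    r : Σ (Tape Γ) λ T' → Plus (config (Execute q false oe) T) (config (Execute q' (isBlank y) oe) T') × T' ≈ leftCells lb , (headCells h rb hb' ++ Rr ++ rightRegion (g' g) w' ob)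
    r = reachCong⁺ refl (cong (λ z → headCells h rb hb' ++ Rr ++ z) (trans (cong (λ z → □ ∷ replicate g □ ++ □ ∷ z) (sym (eY ob))) (eg g ob)))
          (trip ⁺⊙ fetchInputBit q oe (leftCells lb) (H ++ Rr) (++⁺ (cells-IsBit true h (null rb) (u , l)) (rightCells-IsBit rb)) g b y (Yr ob)
           ⊙ weaken back) T tp

  simulate-readBit : ∀ q b w' P o f T oe → Represents (sconf q (b ∷ w') P o) false oe T → sfinal q ≡ false → sinstr q ≡ readIn f →
    StepSimulated (sconf q (b ∷ w') P o) false oe T (sconf (proj₂ (f (bit b))) w' (writeCur (cur P [ proj₁ (f (bit b)) ]≔ just (bit b)) P) o)
  simulate-readBit q b [] P o f T oe inv fq iq =
    simulate-readBit′ q b [] P o f T oe □ (map bit) (λ g → suc (suc g)) inv fq iq (λ ob → refl) refl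
      (λ g ob → cong (□ ∷_) (trans (replicate-□-∷ g (□ ∷ map bit ob)) (cong (□ ∷_) (replicate-□-∷ g (map bit ob)))))
  simulate-readBit q b (b' ∷ w'') P o f T oe inv fq iq =
    simulate-readBit′ q b (b' ∷ w'') P o f T oe (bit b') (λ ob → map bit w'' ++ □ ∷ map bit ob) suc inv fq iq (λ ob → refl) (isbb b')
      (λ g ob → cong (□ ∷_) (replicate-□-∷ g _))
    where
    isbb : ∀ x → isBlank (bit x) ≡ false
    isbb false = refl
    isbb true = refl

  retarget : ∀ {i j T m} → TM.final tm i ≡ false → TM.δ tm i (cur T) ≡ TM.δ tm j (cur T) → TStep tm (tconf j T) m → TStep tm (tconf i T) m
  retarget fi e (t-step f e') = t-step fi (trans e e')

  retargetFirst : ∀ {q q' a X C r Y D} → isFinal q ≡ false → transition q a ≡ transition q' a → Reach⁺ q' X (a ∷ C) r Y D → Reach⁺ q X (a ∷ C) r Y D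
  retargetFirst {q} {q'} {a} fq e f T p with f T p
  ... | T' , (m , s1 , r1) , p' = T' , (m , retarget (trans (cong isFinal (fromFin-toFin State-finite q)) fq) eδ s1 , r1) , p'
    where
    eδ : codeTransition (transition (fromFin State-finite (code q)) (cur T)) ≡ codeTransition (transition (fromFin State-finite (code q')) (cur T))
    eδ = trans (cong (λ z → codeTransition (transition z (cur T))) (fromFin-toFin State-finite q))
           (trans (cong (λ z → codeTransition (transition q z)) (≈c p))
             (trans (cong codeTransition e)
               (trans (cong (λ z → codeTransition (transition q' z)) (sym (≈c p))) (cong (λ z → codeTransition (transition z (cur T))) (sym (fromFin-toFin State-finite q'))))))

  walkLeftFrom′ : ∀ q0 q (P : Γ → Set) c₀ a → isFinal q0 ≡ false → isFinal q ≡ false → (∀ y → P y → transition q y ≡ just (q , y , L)) →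
            transition q0 c₀ ≡ just (q , a , L) → ∀ rs → All P rs → ∀ X x C →
            Reach⁺ q0 (X ++ x ∷ reverse rs) (c₀ ∷ C) q X (x ∷ reverse rs ++ a ∷ C)
  walkLeftFrom′ q0 q P c₀ a f0 fq eP e0 [] [] X x C = stepL f0 e0
  walkLeftFrom′ q0 q P c₀ a f0 fq eP e0 (r ∷ rs) (pr ∷ prs) X x C =
    reachCongL⁺ beforeHead refl
      (reachCong⁺ refl fromHead
        (stepL f0 e0 ⁺⊙ weaken (walkLeftFrom′ q q P r r fq fq eP (eP r pr) rs prs X x (a ∷ C))))
    where
    beforeHead : X ++ x ∷ reverse (r ∷ rs) ≡ (X ++ x ∷ reverse rs) ++ r ∷ []
    beforeHead = trans (cong (λ z → X ++ x ∷ z) (unfold-reverse r rs)) (sym (++-assoc X (x ∷ reverse rs) (r ∷ [])))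
    fromHead : x ∷ reverse rs ++ r ∷ a ∷ C ≡ x ∷ reverse (r ∷ rs) ++ a ∷ C
    fromHead = cong (x ∷_) (trans (sym (++-assoc (reverse rs) (r ∷ []) (a ∷ C))) (cong (_++ a ∷ C) (sym (unfold-reverse r rs))))

  walkLeftFrom : ∀ q0 q (P : Γ → Set) c₀ a → isFinal q0 ≡ false → isFinal q ≡ false → (∀ y → P y → transition q y ≡ just (q , y , L)) →
           transition q0 c₀ ≡ just (q , a , L) → ∀ ys → All P ys → ∀ X x C →
           Reach⁺ q0 (X ++ x ∷ ys) (c₀ ∷ C) q X (x ∷ ys ++ a ∷ C)
  walkLeftFrom q0 q P c₀ a f0 fq eP e0 ys pys X x C =
    subst (λ z → Reach⁺ q0 (X ++ x ∷ z) (c₀ ∷ C) q X (x ∷ z ++ a ∷ C)) (reverse-involutive ys)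
      (walkLeftFrom′ q0 q P c₀ a f0 fq eP e0 (reverse ys) (All-reverse ys pys) X x C)

  bit-stepL : ∀ q → transition q 𝟘 ≡ just (q , 𝟘 , L) → transition q 𝟙 ≡ just (q , 𝟙 , L) → ∀ a → IsBit a → transition q a ≡ just (q , a , L)
  bit-stepL q e0 e1 .𝟘 b0 = e0
  bit-stepL q e0 e1 .𝟙 b1 = e1

  bit-stepR : ∀ q → transition q 𝟘 ≡ just (q , 𝟘 , R) → transition q 𝟙 ≡ just (q , 𝟙 , R) → ∀ a → IsBit a → transition q a ≡ just (q , a , R)
  bit-stepR q e0 e1 .𝟘 b0 = e0
  bit-stepR q e0 e1 .𝟙 b1 = e1

  walkBitsR : ∀ q → transition q 𝟘 ≡ just (q , 𝟘 , R) → transition q 𝟙 ≡ just (q , 𝟙 , R) → isFinal q ≡ false →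
              ∀ ys → All IsBit ys → ∀ X C → Reach q X (ys ++ C) q (X ++ ys) C
  walkBitsR q e0 e1 f ys pys X C = walkR q IsBit f (bit-stepR q e0 e1) ys pys X C

  walkBlanksR : ∀ q → transition q □ ≡ just (q , □ , R) → isFinal q ≡ false → ∀ g X C → Reach q X (replicate g □ ++ C) q (X ++ replicate g □) C
  walkBlanksR q e f g X C = walkR q (_≡ □) f (blank-stepR q e) (replicate g □) (replicate⁺ g refl) X C

  replicate-□-∷ʳ : ∀ g → □ ∷ replicate g □ ≡ replicate g □ ++ □ ∷ []
  replicate-□-∷ʳ g = trans (cong (□ ∷_) (sym (++-identityʳ (replicate g □)))) (sym (replicate-□-∷ g []))

  gap-∷ʳ : ∀ (Reg : List Γ) g → (Reg ++ □ ∷ []) ++ replicate g □ ≡ (Reg ++ replicate g □) ++ □ ∷ []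
  gap-∷ʳ Reg g = trans (++-assoc Reg (□ ∷ []) (replicate g □))
           (trans (cong (Reg ++_) (replicate-□-∷ʳ g)) (sym (++-assoc Reg (replicate g □) (□ ∷ []))))

  outputCells-∷ʳ : ∀ ob bb → bitCell bb ∷ outputCells ob ≡ outputCells (ob ++ bb ∷ [])
  outputCells-∷ʳ ob bb = sym (trans (cong reverse (map-++ bitCell ob (bb ∷ []))) (reverse-++ (map bitCell ob) (bitCell bb ∷ [])))

  null-∷ʳ : ∀ (ob : List Bool) bb → true ≡ not (null (ob ++ bb ∷ []))
  null-∷ʳ [] bb = refl
  null-∷ʳ (x ∷ ob) bb = refl

  headColumnOf : Bool → ColumnPair → Column
  headColumnOf false (u , l) = u
  headColumnOf true (u , l) = l

  headColumn-block : ∀ h z u l → headColumn (block true h z u l) ≡ headColumnOf h (u , l)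
  headColumn-block false z u l = upper-block true false z u l
  headColumn-block true z u l = lower-block true true z u l

  Fold-cur : ∀ h P lb hb rb → Fold h P lb hb rb → cur P ≡ headColumnOf h hb
  Fold-cur false P lb (u , l) rb (e , _) = e
  Fold-cur true P lb (u , l) rb (e , _) = e

  gapO-bit : ∀ c bb t → transition (SkipGapBeforeInput bb t) (bit c) ≡ just (SkipInput bb t , bit c , R)
  gapO-bit false bb t = refl
  gapO-bit true bb t = refl

  gapO2-bit : ∀ c bb t → transition (SkipGapBeforeOutput bb t) (bit c) ≡ just (ToOutputEnd bb true t , bit c , R)
  gapO2-bit false bb t = refl
  gapO2-bit true bb t = refl

  module _ (lb : List ColumnPair) (h : Bool) (rb : List ColumnPair) (hb : ColumnPair) (g : ℕ) (bb : Bool) (t : Tag) where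
    private
      H = headCells h rb hb
      Reg = leftCells lb ++ H ++ rightCells rb

      returnFrom : ∀ q Y → isFinal q ≡ false → transition q □ ≡ transition (ReturnLeft t) □ →
                   Reach (q) (Reg ++ replicate g □) (□ ∷ Y) (Read t top zeros) (leftCells lb) (H ++ rightCells rb ++ replicate g □ ++ □ ∷ Y)
      returnFrom q Y fq e = reachCongL (++-assoc₄ (leftCells lb) H (rightCells rb) (replicate g □)) refl
                              (weaken (retargetFirst {q = q} fq e (returnToHead t lb h rb hb (replicate g □) Y (replicate⁺ g refl))))

      appended : ∀ v → replicate g □ ++ □ ∷ map bit v ++ bit bb ∷ [] ≡ □ ∷ replicate g □ ++ map bit (v ++ bb ∷ [])
      appended v = trans (replicate-□-∷ g _) (cong (λ z → □ ∷ replicate g □ ++ z) (sym (map-++ bit v (bb ∷ []))))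

    outputTrip-afterInput : ∀ c w ob →
      Reach⁺ (GoRight (mOut bb t false (not (null ob)))) Reg (rightRegion g (c ∷ w) ob)
             (Read t top zeros) (leftCells lb) (H ++ rightCells rb ++ rightRegion g (c ∷ w) (ob ++ bb ∷ []))
    outputTrip-afterInput c w ob =
      stepR refl refl
      ⁺⊙ walkBlanksR (SkipGapBeforeInput bb t) refl refl g _ _
      ⊙ weaken (stepR refl (gapO-bit c bb t))
      ⊙ walkBitsR (SkipInput bb t) refl refl refl (map bit w) (map-bit-IsBit w) _ (□ ∷ Ob)
      ⊙ weaken (stepR refl refl)
      ⊙ reachCongL refl (sym (++-identityʳ Ob)) (walkBitsR (ToOutputEnd bb false t) refl refl refl Ob (map-bit-IsBit ob) _ [])
      ⊙ respectʳ (∼-hd∷tl [])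
      ⊙ reachCongL (++-assoc Xw (□ ∷ []) Ob) refl
          (weaken (walkLeftFrom (ToOutputEnd bb false t) (BackOverOutput false t) IsBit □ (bit bb) refl refl
                                (bit-stepL (BackOverOutput false t) refl refl) refl Ob (map-bit-IsBit ob) Xw □ []))
      ⊙ reachCongL (trans (++-assoc Xg (bit c ∷ []) (map bit w)) (trans (cong (_++ W) (gap-∷ʳ Reg g)) (++-assoc _ (□ ∷ []) W))) refl
          (weaken (walkLeftFrom (BackOverOutput false t) (BackOverInput t) IsBit □ □ refl refl
                                (bit-stepL (BackOverInput t) refl refl) refl W (map-bit-IsBit (c ∷ w)) _ □ (Ob ++ bit bb ∷ [])))
      ⊙ reachCong refl (cong (λ z → H ++ rightCells rb ++ z)
                         (trans (replicate-□-∷ g _) (cong (λ z → □ ∷ replicate g □ ++ W ++ □ ∷ z) (sym (map-++ bit ob (bb ∷ []))))))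
          (returnFrom (BackOverInput t) (W ++ □ ∷ Ob ++ bit bb ∷ []) refl refl)
      where
      Ob = map bit ob
      W = map bit (c ∷ w)
      Xg = (Reg ++ □ ∷ []) ++ replicate g □
      Xw = (Xg ++ bit c ∷ []) ++ map bit w

    outputTrip-noInput : ∀ o ob →
      Reach⁺ (GoRight (mOut bb t true true)) Reg (rightRegion g [] (o ∷ ob))
             (Read t top zeros) (leftCells lb) (H ++ rightCells rb ++ rightRegion g [] ((o ∷ ob) ++ bb ∷ []))
    outputTrip-noInput o ob =
      stepR refl refl
      ⁺⊙ walkBlanksR (SkipGapBeforeOutput bb t) refl refl g _ _
      ⊙ weaken (stepR refl (gapO2-bit o bb t))
      ⊙ reachCongL refl (sym (++-identityʳ (map bit ob))) (walkBitsR (ToOutputEnd bb true t) refl refl refl (map bit ob) (map-bit-IsBit ob) _ [])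
      ⊙ respectʳ (∼-hd∷tl [])
      ⊙ reachCongL (trans (++-assoc Xg (bit o ∷ []) (map bit ob)) (trans (cong (_++ Ob) (gap-∷ʳ Reg g)) (++-assoc _ (□ ∷ []) Ob))) refl
          (weaken (walkLeftFrom (ToOutputEnd bb true t) (BackOverOutput true t) IsBit □ (bit bb) refl refl
                                (bit-stepL (BackOverOutput true t) refl refl) refl Ob (map-bit-IsBit (o ∷ ob)) _ □ []))
      ⊙ reachCong refl (cong (λ z → H ++ rightCells rb ++ z) (appended (o ∷ ob)))
          (returnFrom (BackOverOutput true t) (Ob ++ bit bb ∷ []) refl refl)
      where
      Ob = map bit (o ∷ ob)
      Xg = (Reg ++ □ ∷ []) ++ replicate g □

    outputTrip-empty :
      Reach⁺ (GoRight (mOut bb t true false)) Reg (rightRegion g [] [])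
             (Read t top zeros) (leftCells lb) (H ++ rightCells rb ++ rightRegion 0 [] (bb ∷ []))
    outputTrip-empty =
      stepR refl refl
      ⁺⊙ respectʳ (subst (_∼ (□ ∷ replicate (Data.Nat.pred g) □)) (sym (++-identityʳ (replicate g □))) (replicate-∼-d∷ g))
      ⊙ weaken (walkLeftFrom (ToOutputEnd bb true t) (BackOverOutput true t) IsBit □ (bit bb) refl refl
                             (bit-stepL (BackOverOutput true t) refl refl) refl [] [] Reg □ _)
      ⊙ reachCongL (cong (λ z → leftCells lb ++ H ++ z) (sym (++-identityʳ (rightCells rb)))) refl
          (weaken (retargetFirst {q = BackOverOutput true t} refl refl
                                 (returnToHead t lb h rb hb [] (bit bb ∷ replicate (Data.Nat.pred g) □) [])))
      ⊙ respectʳ (∼-++ˡ H (∼-++ˡ (rightCells rb) (∼-++ˡ (□ ∷ bit bb ∷ []) (replicate-∼[] (Data.Nat.pred g)))))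

  gapAfterOutput : List Bool → List Bool → ℕ → ℕ
  gapAfterOutput [] [] g = 0
  gapAfterOutput _ _ g = g

  outputTrip : ∀ lb h rb hb g w ob ex oe bb t → ex ≡ null w → oe ≡ not (null ob) →
    Reach⁺ (GoRight (mOut bb t ex oe)) (leftCells lb ++ headCells h rb hb ++ rightCells rb) (rightRegion g w ob)
           (Read t top zeros) (leftCells lb) (headCells h rb hb ++ rightCells rb ++ rightRegion (gapAfterOutput w ob g) w (ob ++ bb ∷ []))
  outputTrip lb h rb hb g (c ∷ w) ob .false .(not (null ob)) bb t refl refl = outputTrip-afterInput lb h rb hb g bb t c w ob
  outputTrip lb h rb hb g [] (o ∷ ob) .true .true bb t refl refl = outputTrip-noInput lb h rb hb g bb t o ob
  outputTrip lb h rb hb g [] [] .true .false bb t refl refl = outputTrip-empty lb h rb hb g bb t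

  outputAction-bit : ∀ b bb q' ex oe → outputAction b (bitCell bb) q' ex oe ≡ just (b , nTrip (mOut bb (tExecute q' ex true) ex oe))
  outputAction-bit b false q' ex oe = refl
  outputAction-bit b true q' ex oe = refl

  simulate-write : ∀ q w P o i q' T ex oe bb → Represents (sconf q w P o) ex oe T → sfinal q ≡ false → sinstr q ≡ writeOut i q' →
            lookup (cur P) i ≡ bitCell bb → StepSimulated (sconf q w P o) ex oe T (sconf q' w P (lookup (cur P) i ∷ o))
  simulate-write q w P o i q' T ex oe bb (represents lb rb (u , l) h g ob fold eout eex eoe tp) fq iq ex0 =
    ex , true , proj₁ r , proj₁ (proj₂ r) ,
    represents lb rb (u , l) h (gapAfterOutput w ob g) (ob ++ bb ∷ []) fold (trans (cong₂ _∷_ ex0 eout) (outputCells-∷ʳ ob bb)) eex (null-∷ʳ ob bb) (proj₂ (proj₂ r))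
    where
    X0 = leftCells lb
    H = headCells h rb (u , l)
    Rr = rightCells rb
    Rp = rightRegion g w ob
    blk = block true h (null rb) u l
    t = tExecute q' ex true
    elk : lookup (headColumn blk) i ≡ bitCell bb
    elk = trans (cong (λ c → lookup c i) (trans (headColumn-block h (null rb) u l) (sym (Fold-cur h P lb (u , l) rb fold)))) ex0
    ea : action (tExecute q ex oe) blk ≡ just (blk , nTrip (mOut bb t ex oe))
    ea = trans (action-execute ex oe blk fq) (trans (cong (λ z → instrAction blk q z ex oe) iq)
           (trans (cong (λ x → outputAction blk x q' ex oe) elk) (outputAction-bit blk bb q' ex oe)))
    r : Σ (Tape Γ) λ T' → Plus (config (Execute q ex oe) T) (config (Execute q' ex true) T') × T' ≈ X0 , (H ++ Rr ++ rightRegion (gapAfterOutput w ob g) w (ob ++ bb ∷ []))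
    r = (updateHeadBlock (tExecute q ex oe) true h (null rb) u l (Rr ++ Rp) blk (nTrip (mOut bb t ex oe)) X0 ea
         ⁺⊙ reachCongL refl (sym (++-assoc H Rr Rp))
              (walkBitsR (GoRight (mOut bb t ex oe)) refl refl refl (H ++ Rr) (++⁺ (cells-IsBit true h (null rb) (u , l)) (rightCells-IsBit rb)) X0 Rp)
         ⊙ weaken (outputTrip lb h rb (u , l) g w ob ex oe bb t eex eoe)) T tp

  dieInRead : ∀ t cs X C → length cs ≡ B → action t (shiftInAll zeros cs) ≡ nothing → Reach⁺ (Read t top zeros) X (cs ++ C) Dead (X ++ cs) C
  dieInRead t cs X C lc ea = subst (λ z → Reach⁺ (Read t top zeros) X (cs ++ C) z (X ++ cs) C) (pd {t} {shiftInAll zeros cs} ea) (readBlock t cs top zeros (trans suc-toℕ-top (sym lc)) X C)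
    where
    pd : ∀ {t b} → action t b ≡ nothing → afterRead t b ≡ Dead
    pd {t} {b} e rewrite e = refl

  dies : ∀ {q w P o ex oe T} → Represents (sconf q w P o) ex oe T → sfinal q ≡ false →
         (∀ b → headColumn b ≡ cur P → instrAction b q (sinstr q) ex oe ≡ nothing) →
         Σ (Tape Γ) λ T' → Star Step (config (Execute q ex oe) T) (config Dead T')
  dies {q} {w} {P} {ex = ex} {oe} {T} (represents lb rb (u , l) h g ob fold _ _ _ tp) fq stuck
    with dieInRead (tExecute q ex oe) (cells true h (null rb) (u , l)) (leftCells lb) (rightCells rb ++ rightRegion g w ob)
                   (length-cells true h (null rb) (u , l)) ea T tp
    where
    blk = block true h (null rb) u l
    ea : action (tExecute q ex oe) (shiftInAll zeros (cells true h (null rb) (u , l))) ≡ nothing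
    ea = trans (cong (action (tExecute q ex oe)) (shiftInAll-blockCells blk))
               (trans (action-execute ex oe blk fq) (stuck blk (trans (headColumn-block h (null rb) u l) (sym (Fold-cur h P lb (u , l) rb fold)))))
  ... | T' , (_ , s₁ , r₁) , _ = T' , s₁ ◅ r₁

  writeMove : Dir → Column → Tape Column → Tape Column
  writeMove d c P = move emptyColumn d (writeCur c P)

  headPair : List ColumnPair → ColumnPair
  headPair [] = emptyColumn , emptyColumn
  headPair (b ∷ _) = b

  tailPairs : List ColumnPair → List ColumnPair
  tailPairs [] = []
  tailPairs (_ ∷ lb) = lb

  hd-map₁ : ∀ lb → hdE (map proj₁ lb) ≡ proj₁ (headPair lb)
  hd-map₁ [] = refl
  hd-map₁ (b ∷ lb) = refl

  hd-map₂ : ∀ lb → hdE (map proj₂ lb) ≡ proj₂ (headPair lb)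
  hd-map₂ [] = refl
  hd-map₂ (b ∷ lb) = refl

  tl-map₁ : ∀ lb → tlE (map proj₁ lb) ≡ map proj₁ (tailPairs lb)
  tl-map₁ [] = refl
  tl-map₁ (b ∷ lb) = refl

  tl-map₂ : ∀ lb → tlE (map proj₂ lb) ≡ map proj₂ (tailPairs lb)
  tl-map₂ [] = refl
  tl-map₂ (b ∷ lb) = refl

  shift-∼ : ∀ (A Rv : List Column) x (lb : List ColumnPair) f → f (emptyColumn , emptyColumn) ≡ emptyColumn → (A ++ Rv ++ x ∷ map f lb) Col.∼ (A ++ (Rv ++ x ∷ []) ++ f (headPair lb) ∷ map f (tailPairs lb))
  shift-∼ A Rv x [] f fe rewrite fe = subst (λ z → (A ++ Rv ++ x ∷ []) Col.∼ z) e (Col.∼-∷ʳ (Col.∼-refl _))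
    where
    e : (A ++ Rv ++ x ∷ []) ++ emptyColumn ∷ [] ≡ A ++ (Rv ++ x ∷ []) ++ emptyColumn ∷ []
    e = ++-assoc A (Rv ++ x ∷ []) _
  shift-∼ A Rv x (b ∷ lb) f fe = subst (λ z → (A ++ Rv ++ x ∷ f b ∷ map f lb) Col.∼ z) e (Col.∼-refl _)
    where
    e : A ++ Rv ++ x ∷ f b ∷ map f lb ≡ A ++ (Rv ++ x ∷ []) ++ f b ∷ map f lb
    e = cong (A ++_) (sym (++-assoc Rv (x ∷ []) _))

  reverse-∷-++ : ∀ (x : Column) xs (Z : List Column) → reverse (x ∷ xs) ++ Z ≡ reverse xs ++ x ∷ Z
  reverse-∷-++ x xs Z = trans (cong (_++ Z) (unfold-reverse x xs)) (++-assoc (reverse xs) (x ∷ []) Z)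

  Fold-upperR : ∀ P lb u l rb col' → Fold false P lb (u , l) rb → Fold false (writeMove R col' P) (tailPairs lb) (headPair lb) ((col' , l) ∷ rb)
  Fold-upperR P lb u l rb col' (ec , el , er) rewrite Col.move-hd-tl R (writeCur col' P) =
    trans (Col.∼-hd er) (hd-map₁ lb) ,
    Col.∼-trans (Col.cons col' el)
      (subst (λ z → (col' ∷ map proj₁ rb ++ reverse (map proj₂ rb) ++ l ∷ map proj₂ lb) Col.∼ (col' ∷ map proj₁ rb ++ z))
             (sym (reverse-∷-++ l (map proj₂ rb) _)) (Col.cons col' (Col.∼-trans (shift-∼ (map proj₁ rb) (reverse (map proj₂ rb)) l lb proj₂ refl)
               (subst (λ z → (map proj₁ rb ++ (reverse (map proj₂ rb) ++ l ∷ []) ++ proj₂ (headPair lb) ∷ map proj₂ (tailPairs lb)) Col.∼ (map proj₁ rb ++ z))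
                      (++-assoc (reverse (map proj₂ rb)) (l ∷ []) _) (Col.∼-refl _))))) ,
    subst (tlE (right P) Col.∼_) (tl-map₁ lb) (Col.∼-tl er)

  Fold-upperL-origin : ∀ P lb u l col' → Fold false P lb (u , l) [] → Fold true (writeMove L col' P) lb (col' , l) []
  Fold-upperL-origin P lb u l col' (ec , el , er) rewrite Col.move-hd-tl L (writeCur col' P) = Col.∼-hd el , Col.∼-tl el , Col.cons col' er

  Fold-upperL : ∀ P lb u l u1 l1 rb' col' → Fold false P lb (u , l) ((u1 , l1) ∷ rb') → Fold false (writeMove L col' P) ((col' , l) ∷ lb) (u1 , l1) rb'
  Fold-upperL P lb u l u1 l1 rb' col' (ec , el , er) rewrite Col.move-hd-tl L (writeCur col' P) =
    Col.∼-hd el ,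
    subst (tlE (left P) Col.∼_) (cong (map proj₁ rb' ++_) (reverse-∷-++ l1 (map proj₂ rb') _)) (Col.∼-tl el) ,
    Col.cons col' er

  Fold-lowerL : ∀ P lb u l rb col' → Fold true P lb (u , l) rb → Fold true (writeMove L col' P) (tailPairs lb) (headPair lb) ((u , col') ∷ rb)
  Fold-lowerL P lb u l rb col' (ec , el , er) rewrite Col.move-hd-tl L (writeCur col' P) =
    trans (Col.∼-hd el) (hd-map₂ lb) ,
    subst (tlE (left P) Col.∼_) (tl-map₂ lb) (Col.∼-tl el) ,
    Col.∼-trans (Col.cons col' er)
      (subst (λ z → (col' ∷ map proj₂ rb ++ reverse (map proj₁ rb) ++ u ∷ map proj₁ lb) Col.∼ (col' ∷ map proj₂ rb ++ z))
             (sym (reverse-∷-++ u (map proj₁ rb) _)) (Col.cons col' (Col.∼-trans (shift-∼ (map proj₂ rb) (reverse (map proj₁ rb)) u lb proj₁ refl)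
               (subst (λ z → (map proj₂ rb ++ (reverse (map proj₁ rb) ++ u ∷ []) ++ proj₁ (headPair lb) ∷ map proj₁ (tailPairs lb)) Col.∼ (map proj₂ rb ++ z))
                      (++-assoc (reverse (map proj₁ rb)) (u ∷ []) _) (Col.∼-refl _)))))

  Fold-lowerR-origin : ∀ P lb u l col' → Fold true P lb (u , l) [] → Fold false (writeMove R col' P) lb (u , col') []
  Fold-lowerR-origin P lb u l col' (ec , el , er) rewrite Col.move-hd-tl R (writeCur col' P) = Col.∼-hd er , Col.cons col' el , Col.∼-tl er

  Fold-lowerR : ∀ P lb u l u1 l1 rb' col' → Fold true P lb (u , l) ((u1 , l1) ∷ rb') → Fold true (writeMove R col' P) ((u , col') ∷ lb) (u1 , l1) rb'
  Fold-lowerR P lb u l u1 l1 rb' col' (ec , el , er) rewrite Col.move-hd-tl R (writeCur col' P) =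
    Col.∼-hd er ,
    Col.cons col' el ,
    subst (tlE (right P) Col.∼_) (cong (map proj₂ rb' ++_) (reverse-∷-++ u1 (map proj₁ rb') _)) (Col.∼-tl er)

  rightCells-∷ : ∀ b rb → rightCells (b ∷ rb) ≡ cells false false (null rb) b ++ rightCells rb
  rightCells-∷ b [] = sym (++-identityʳ _)
  rightCells-∷ b (b' ∷ rb) = refl

  []∼-blanks : ∀ l → All (_≡ □) l → [] ∼ l
  []∼-blanks [] [] = nil
  []∼-blanks (.□ ∷ l) (refl ∷ ps) = padʳ ([]∼-blanks l ps)

  action-mark : ∀ h' q' ex oe z u l → action (tMark h' q' ex oe) (block false false z u l) ≡ just (block true h' z u l , nRead (tExecute q' ex oe))
  action-mark h' q' ex oe z u l rewrite upper-block false false z u l | lower-block false false z u l = refl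

  markLeftBlock : ∀ h' q' ex oe lb z b C →
    Reach⁺ (HopLeft top (tMark h' q' ex oe)) (leftCells lb) (cells false false z b ++ C)
           (Execute q' ex oe) (leftCells (tailPairs lb)) (cells true h' false (headPair lb) ++ cells false false z b ++ C)
  markLeftBlock h' q' ex oe [] z b C =
    reachRespL⁺ ([]∼-blanks (reverse (replicate B □)) (All-reverse (replicate B □) (replicate⁺ B refl))) (∼-refl _)
      (countLeft (λ c → HopLeft c t) (Read t top zeros) (λ _ → refl) (λ _ → refl) (λ _ _ → refl)
                 (replicate B □) top (trans suc-toℕ-top (sym (length-replicate B))) [] 𝟘 _
       ⁺⊙ weaken (updateBlock t (replicate B □) (block true h' false emptyColumn emptyColumn) (nRead (tExecute q' ex oe)) [] (cells false false z b ++ C)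
                   (length-replicate B) (trans (cong (action t) shiftInAll-blanks) (action-mark h' q' ex oe false emptyColumn emptyColumn))))
    where
    t = tMark h' q' ex oe
  markLeftBlock h' q' ex oe ((u1 , l1) ∷ lb) z b C =
    countLeft (λ c → HopLeft c t) (Read t top zeros) (λ _ → refl) (λ _ → refl) (λ _ _ → refl)
              (plainCells (u1 , l1)) top (trans suc-toℕ-top (sym (length-cells false false false (u1 , l1)))) (leftCells lb) 𝟘 _
    ⁺⊙ weaken (updateHeadBlock t false false false u1 l1 (cells false false z b ++ C) (block true h' false u1 l1) (nRead (tExecute q' ex oe)) (leftCells lb)
                (action-mark h' q' ex oe false u1 l1))
    where
    t = tMark h' q' ex oe

  markRightBlock : ∀ h' q' ex oe lb ns u1 l1 rb' C → length ns ≡ B →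
    Reach⁺ (HopRight top (tMark h' q' ex oe)) (leftCells lb) (ns ++ rightCells ((u1 , l1) ∷ rb') ++ C)
           (Execute q' ex oe) (leftCells lb ++ ns) (cells true h' (null rb') (u1 , l1) ++ rightCells rb' ++ C)
  markRightBlock h' q' ex oe lb ns u1 l1 rb' C lns =
    countRight (λ c → HopRight c t) (Read t top zeros) (λ _ → refl) (λ _ → refl) (λ _ _ → refl) ns top (trans suc-toℕ-top (sym lns)) (leftCells lb) _
    ⁺⊙ reachCongL refl (cong (_++ C) (rightCells-∷ (u1 , l1) rb') ∙′ ++-assoc (cells false false (null rb') (u1 , l1)) (rightCells rb') C)
         (weaken (updateHeadBlock t false false (null rb') u1 l1 (rightCells rb' ++ C) (block true h' (null rb') u1 l1) (nRead (tExecute q' ex oe)) (leftCells lb ++ ns)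
                    (action-mark h' q' ex oe (null rb') u1 l1)))
    where
    t = tMark h' q' ex oe
    _∙′_ = trans

  ηUpdate : ∀ q ex oe h z u l g (U : SCP s) col' d q' buf nx X C → sfinal q ≡ false → sinstr q ≡ stepη g →
         g (headColumnOf h (u , l)) ≡ just (U , col' , d , q') → moveAction (block true h z u l) col' d q' ex oe ≡ just (buf , nx) →
         Reach⁺ (Execute q ex oe) X (cells true h z (u , l) ++ C) (start nx) X (map bit (toList buf) ++ C)
  ηUpdate q ex oe h z u l g U col' d q' buf nx X C fq iq eg em =
    updateHeadBlock (tExecute q ex oe) true h z u l C buf nx X
      (trans (action-execute ex oe blk fq) (trans (cong (λ i → instrAction blk q i ex oe) iq)
        (trans (cong (λ c → ηAction blk (g c) ex oe) (headColumn-block h z u l)) (trans (cong (λ r → ηAction blk r ex oe) eg) em))))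
    where
    blk = block true h z u l

  moveAction-upperR : ∀ z u l col' q' ex oe → moveAction (block true false z u l) col' R q' ex oe ≡ just (block false false z col' l , nHopLeft (tMark false q' ex oe))
  moveAction-upperR z u l col' q' ex oe rewrite lower-block true false z u l = refl
  moveAction-upperL-origin : ∀ u l col' q' ex oe → moveAction (block true false true u l) col' L q' ex oe ≡ just (block true true true col' l , nRead (tExecute q' ex oe))
  moveAction-upperL-origin u l col' q' ex oe rewrite lower-block true false true u l = refl
  moveAction-upperL : ∀ u l col' q' ex oe → moveAction (block true false false u l) col' L q' ex oe ≡ just (block false false false col' l , nHopRight (tMark false q' ex oe))
  moveAction-upperL u l col' q' ex oe rewrite lower-block true false false u l = refl
  moveAction-lowerL : ∀ z u l col' q' ex oe → moveAction (block true true z u l) col' L q' ex oe ≡ just (block false false z u col' , nHopLeft (tMark true q' ex oe))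
  moveAction-lowerL z u l col' q' ex oe rewrite upper-block true true z u l = refl
  moveAction-lowerR-origin : ∀ u l col' q' ex oe → moveAction (block true true true u l) col' R q' ex oe ≡ just (block true false true u col' , nRead (tExecute q' ex oe))
  moveAction-lowerR-origin u l col' q' ex oe rewrite upper-block true true true u l = refl
  moveAction-lowerR : ∀ u l col' q' ex oe → moveAction (block true true false u l) col' R q' ex oe ≡ just (block false false false u col' , nHopRight (tMark true q' ex oe))
  moveAction-lowerR u l col' q' ex oe rewrite upper-block true true false u l = refl

  simulate-η : ∀ q w P o g (U : SCP s) col' d q' T ex oe → Represents (sconf q w P o) ex oe T → sfinal q ≡ false → sinstr q ≡ stepη g →
            g (cur P) ≡ just (U , col' , d , q') → StepSimulated (sconf q w P o) ex oe T (sconf q' w (writeMove d col' P) o)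
  simulate-η q w P o g U col' R q' T ex oe (represents lb rb (u , l) false g0 ob fold eout eex eoe tp) fq iq eg =
    ex , oe , proj₁ r , proj₁ (proj₂ r) , represents (tailPairs lb) ((col' , l) ∷ rb) (headPair lb) false g0 ob (Fold-upperR P lb u l rb col' fold) eout eex eoe (proj₂ (proj₂ r))
    where
    Rp = rightRegion g0 w ob
    eg' = trans (cong g (sym (Fold-cur false P lb (u , l) rb fold))) eg
    r = (reachCong⁺ refl (cong (cells true false false (headPair lb) ++_)
           (trans (sym (++-assoc (cells false false (null rb) (col' , l)) (rightCells rb) Rp)) (cong (_++ Rp) (sym (rightCells-∷ (col' , l) rb)))))
          (ηUpdate q ex oe false (null rb) u l g U col' R q' _ _ (leftCells lb) (rightCells rb ++ Rp) fq iq eg' (moveAction-upperR (null rb) u l col' q' ex oe)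
           ⁺⊙ weaken (markLeftBlock false q' ex oe lb (null rb) (col' , l) (rightCells rb ++ Rp)))) T tp
  simulate-η q w P o g U col' L q' T ex oe (represents lb [] (u , l) false g0 ob fold eout eex eoe tp) fq iq eg =
    ex , oe , proj₁ r , proj₁ (proj₂ r) , represents lb [] (col' , l) true g0 ob (Fold-upperL-origin P lb u l col' fold) eout eex eoe (proj₂ (proj₂ r))
    where
    Rp = rightRegion g0 w ob
    eg' = trans (cong g (sym (Fold-cur false P lb (u , l) [] fold))) eg
    r = ηUpdate q ex oe false true u l g U col' L q' _ _ (leftCells lb) ([] ++ Rp) fq iq eg' (moveAction-upperL-origin u l col' q' ex oe) T tp
  simulate-η q w P o g U col' L q' T ex oe (represents lb ((u1 , l1) ∷ rb') (u , l) false g0 ob fold eout eex eoe tp) fq iq eg =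
    ex , oe , proj₁ r , proj₁ (proj₂ r) , represents ((col' , l) ∷ lb) rb' (u1 , l1) false g0 ob (Fold-upperL P lb u l u1 l1 rb' col' fold) eout eex eoe (proj₂ (proj₂ r))
    where
    Rp = rightRegion g0 w ob
    eg' = trans (cong g (sym (Fold-cur false P lb (u , l) ((u1 , l1) ∷ rb') fold))) eg
    r = (ηUpdate q ex oe false false u l g U col' L q' _ _ (leftCells lb) (rightCells ((u1 , l1) ∷ rb') ++ Rp) fq iq eg' (moveAction-upperL u l col' q' ex oe)
         ⁺⊙ weaken (markRightBlock false q' ex oe lb (plainCells (col' , l)) u1 l1 rb' Rp (length-cells false false false (col' , l)))) T tp
  simulate-η q w P o g U col' L q' T ex oe (represents lb rb (u , l) true g0 ob fold eout eex eoe tp) fq iq eg =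
    ex , oe , proj₁ r , proj₁ (proj₂ r) , represents (tailPairs lb) ((u , col') ∷ rb) (headPair lb) true g0 ob (Fold-lowerL P lb u l rb col' fold) eout eex eoe (proj₂ (proj₂ r))
    where
    Rp = rightRegion g0 w ob
    eg' = trans (cong g (sym (Fold-cur true P lb (u , l) rb fold))) eg
    r = (reachCong⁺ refl (cong (cells true true false (headPair lb) ++_)
           (trans (sym (++-assoc (cells false false (null rb) (u , col')) (rightCells rb) Rp)) (cong (_++ Rp) (sym (rightCells-∷ (u , col') rb)))))
          (ηUpdate q ex oe true (null rb) u l g U col' L q' _ _ (leftCells lb) (rightCells rb ++ Rp) fq iq eg' (moveAction-lowerL (null rb) u l col' q' ex oe)
           ⁺⊙ weaken (markLeftBlock true q' ex oe lb (null rb) (u , col') (rightCells rb ++ Rp)))) T tp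
  simulate-η q w P o g U col' R q' T ex oe (represents lb [] (u , l) true g0 ob fold eout eex eoe tp) fq iq eg =
    ex , oe , proj₁ r , proj₁ (proj₂ r) , represents lb [] (u , col') false g0 ob (Fold-lowerR-origin P lb u l col' fold) eout eex eoe (proj₂ (proj₂ r))
    where
    Rp = rightRegion g0 w ob
    eg' = trans (cong g (sym (Fold-cur true P lb (u , l) [] fold))) eg
    r = ηUpdate q ex oe true true u l g U col' R q' _ _ (leftCells lb) ([] ++ Rp) fq iq eg' (moveAction-lowerR-origin u l col' q' ex oe) T tp
  simulate-η q w P o g U col' R q' T ex oe (represents lb ((u1 , l1) ∷ rb') (u , l) true g0 ob fold eout eex eoe tp) fq iq eg =
    ex , oe , proj₁ r , proj₁ (proj₂ r) , represents ((u , col') ∷ lb) rb' (u1 , l1) true g0 ob (Fold-lowerR P lb u l u1 l1 rb' col' fold) eout eex eoe (proj₂ (proj₂ r))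
    where
    Rp = rightRegion g0 w ob
    eg' = trans (cong g (sym (Fold-cur true P lb (u , l) ((u1 , l1) ∷ rb') fold))) eg
    r = (ηUpdate q ex oe true false u l g U col' R q' _ _ (leftCells lb) (rightCells ((u1 , l1) ∷ rb') ++ Rp) fq iq eg' (moveAction-lowerR u l col' q' ex oe)
         ⁺⊙ weaken (markRightBlock true q' ex oe lb (plainCells (u , col')) u1 l1 rb' Rp (length-cells false false false (u , col')))) T tp

  reads-bits : ∀ v T X C → T ≈ X , (map bit v ++ C) → hd C ≡ □ → ReadsWord tm T v
  reads-bits [] T X C p e = rw-end (trans (≈c p) e)
  reads-bits (b ∷ v) T X C p e = rw-cons (≈c p) (reads-bits v (move □ R T) (X ++ bit b ∷ []) C (≈-moveR p) e)

  reads-bits-end : ∀ v {T X} → T ≈ X , map bit v → ReadsWord tm T v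
  reads-bits-end v {T} {X} p = reads-bits v T X [] (subst (λ z → T ≈ X , z) (sym (++-identityʳ (map bit v))) p) refl

  gapH-bit-true : ∀ c → transition (HaltSkipGap true) (bit c) ≡ just (HaltAlign R , bit c , L)
  gapH-bit-true false = refl
  gapH-bit-true true = refl

  gapH-bit-false : ∀ c → transition (HaltSkipGap false) (bit c) ≡ just (HaltSkipInput , bit c , R)
  gapH-bit-false false = refl
  gapH-bit-false true = refl

  haltTrip : ∀ lb h rb hb g w ob ex oe → ex ≡ null w → oe ≡ not (null ob) → ∀ T →
    T ≈ (leftCells lb ++ headCells h rb hb ++ rightCells rb) , rightRegion g w ob →
    Σ (Tape Γ) λ T' → Star Step (config (GoRight (mHalt ex oe)) T) (config Stop T') × ReadsWord tm T' ob
  haltTrip lb h rb hb g w [] ex .false eex refl T p with (weaken (stepR refl refl) ⊙ respectʳ (∼-hd∷tl _) ⊙ weaken (stepL refl refl)) T p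
  ... | T' , r , p' = T' , r , rw-end (≈c p')
  haltTrip lb h rb hb g (c ∷ w'') (o1 ∷ obr) .false .true refl refl T p
    with (weaken (stepR refl refl) ⊙ walkBlanksR (HaltSkipGap false) refl refl g _ _ ⊙ weaken (stepR refl (gapH-bit-false c))
          ⊙ walkBitsR HaltSkipInput refl refl refl (map bit w'') (map-bit-IsBit w'') _ _ ⊙ weaken (stepR refl refl)) T p
  ... | T' , r , p' = T' , r , reads-bits-end (o1 ∷ obr) p'
  haltTrip lb h rb hb g [] (o1 ∷ obr) .true .true refl refl T p
    with (weaken (stepR refl refl) ⊙ walkBlanksR (HaltSkipGap true) refl refl g _ _
          ⊙ reachCongL (gap-∷ʳ (leftCells lb ++ headCells h rb hb ++ rightCells rb) g) refl (weaken (stepL refl (gapH-bit-true o1))) ⊙ weaken (stepR refl refl)) T p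
  ... | T' , r , p' = T' , r , reads-bits-end (o1 ∷ obr) p'

  simulate-halt : ∀ q w P o ex oe T (inv : Represents (sconf q w P o) ex oe T) → sfinal q ≡ true →
                  Σ (Tape Γ) λ T' → Star Step (config (Execute q ex oe) T) (config Stop T') × ReadsWord tm T' (Represents.ob inv)
  simulate-halt q w P o ex oe T (represents lb rb (u , l) h g ob fold eout eex eoe tp) fq =
    let T₁ , (_ , s₁ , r₁) , p₁ = toTrip T tp
        T' , r₂ , rw = haltTrip lb h rb (u , l) g w ob ex oe eex eoe T₁ p₁
    in T' , s₁ ◅ (r₁ ◅◅ r₂) , rw
    where
    H = headCells h rb (u , l)
    Rr = rightCells rb
    Rp = rightRegion g w ob
    blk = block true h (null rb) u l
    toTrip : Reach⁺ (Execute q ex oe) (leftCells lb) (H ++ Rr ++ Rp) (GoRight (mHalt ex oe)) (leftCells lb ++ H ++ Rr) Rp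
    toTrip = updateHeadBlock (tExecute q ex oe) true h (null rb) u l (Rr ++ Rp) blk (nTrip (mHalt ex oe)) (leftCells lb)
                             (cong (λ z → execAction blk q z ex oe) fq)
             ⁺⊙ reachCongL refl (sym (++-assoc H Rr Rp))
                  (walkBitsR (GoRight (mHalt ex oe)) refl refl refl (H ++ Rr)
                             (++⁺ (cells-IsBit true h (null rb) (u , l)) (rightCells-IsBit rb)) (leftCells lb) Rp)

  inputTape-≈ : ∀ w → inputTape tm w ≈ [] , map bit w
  inputTape-≈ [] = mk≈ nil refl nil
  inputTape-≈ (b ∷ w) = mk≈ nil refl (∼-refl _)

  map-bit-∼-inputOutput : ∀ w → map bit w ∼ inputOutput w []
  map-bit-∼-inputOutput [] = nil
  map-bit-∼-inputOutput (b ∷ w) = ∼-∷ʳ (∼-refl _)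

  isBlank-null : ∀ w → isBlank (hd (map bit w)) ≡ null w
  isBlank-null [] = refl
  isBlank-null (false ∷ w) = refl
  isBlank-null (true ∷ w) = refl

  initialise : ∀ w → Σ (Tape Γ) λ T' → Star Step (tinit tm w) (config (Execute sq₀ (null w) false) T')
                                     × Represents (sinit M w) (null w) false T'
  initialise w =
    let T₁ , run , p = setUp (inputTape tm w) (inputTape-≈ w)
    in T₁ , subst (λ z → Star Step (tinit tm w) (config (Execute sq₀ z false) T₁)) (isBlank-null w) run ,
       represents [] [] (emptyColumn , emptyColumn) false 0 [] (refl , Col.padʳ Col.nil , Col.nil) refl refl refl
         (≈-resp p (∼-refl _) (∼-++ˡ originCells (cons □ (∼-trans (∼-sym (∼-hd∷tl (map bit w))) (map-bit-∼-inputOutput w)))))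
    where
    c₀ = hd (map bit w)
    originCells = cells true false true (emptyColumn , emptyColumn)
    setUp : Reach Init [] (map bit w) (Execute sq₀ (isBlank c₀) false) [] (originCells ++ □ ∷ c₀ ∷ tl (map bit w))
    setUp = respectʳ (∼-hd∷tl (map bit w))
          ⊙ respect {X = []} {X' = □ ∷ []} (padʳ nil) (∼-refl _)
          ⊙ weaken (stepL {X = []} refl refl)
          ⊙ respect {X = []} {X' = replicate B □} ([]∼-blanks (reverse (replicate B □)) (All-reverse (replicate B □) (replicate⁺ B refl))) (∼-refl _)
          ⊙ weaken (countLeft (λ c → HopLeft c (tInit (isBlank c₀))) (Read (tInit (isBlank c₀)) top zeros) (λ _ → refl) (λ _ → refl) (λ _ _ → refl)
                              (replicate B □) top (trans suc-toℕ-top (sym (length-replicate B))) [] □ (c₀ ∷ tl (map bit w)))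
          ⊙ weaken (updateBlock (tInit (isBlank c₀)) (replicate B □) (block true false true emptyColumn emptyColumn)
                                (nRead (tExecute sq₀ (isBlank c₀) false)) [] (□ ∷ c₀ ∷ tl (map bit w))
                                (length-replicate B) (cong (action (tInit (isBlank c₀))) shiftInAll-blanks))

  isBitCell? : ∀ x → IsBitCell x ⊎ ((∀ blk q' ex oe → outputAction blk x q' ex oe ≡ nothing) × (IsBitCell x → ⊥))
  isBitCell? nothing = inj₂ ((λ _ _ _ _ → refl) , λ { (b , ()) })
  isBitCell? (just 𝟘) = inj₁ (false , refl)
  isBitCell? (just 𝟙) = inj₁ (true , refl)
  isBitCell? (just □) = inj₂ ((λ _ _ _ _ → refl) , λ { (false , ()) ; (true , ()) })

  Progress : SConf M → Bool → Bool → Tape Γ → Set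
  Progress sc ex oe T = (Σ (SConf M) λ sc' → SStep M sc sc' × StepSimulated sc ex oe T sc')
                  ⊎ ((∀ sc' → SStep M sc sc' → AllBitCells (SConf.output sc') → ⊥) ×
                     (Σ (Tape Γ) λ T' → Star Step (config (Execute (SConf.state sc) ex oe) T) (config Dead T')))

  progress-read : ∀ q w P o f ex oe T → Represents (sconf q w P o) ex oe T → sfinal q ≡ false → sinstr q ≡ readIn f → Progress (sconf q w P o) ex oe T
  progress-read q [] P o f ex oe T inv fq iq with Represents.eex inv
  ... | refl = inj₁ (_ , δ-step {i = proj₁ (f □)} {q' = proj₂ (f □)} fq iq refl , simulate-readEnd q P o f T oe inv fq iq)
  progress-read q (b ∷ w) P o f ex oe T inv fq iq with Represents.eex inv
  ... | refl = inj₁ (_ , δ-step {i = proj₁ (f (bit b))} {q' = proj₂ (f (bit b))} fq iq refl , simulate-readBit q b w P o f T oe inv fq iq)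

  progress-write : ∀ q w P o i q' ex oe T → Represents (sconf q w P o) ex oe T → sfinal q ≡ false → sinstr q ≡ writeOut i q' → Progress (sconf q w P o) ex oe T
  progress-write q w P o i q' ex oe T inv fq iq with isBitCell? (lookup (cur P) i)
  ... | inj₁ (bb , e) = inj₁ (_ , γ-step fq iq , simulate-write q w P o i q' T ex oe bb inv fq iq e)
  ... | inj₂ (bad , ng) = inj₂ (claim , dies inv fq λ b e →
          trans (cong (λ z → instrAction b q z ex oe) iq) (trans (cong (λ c → outputAction b (lookup c i) q' ex oe) e) (bad b q' ex oe)))
    where
    claim : ∀ sc' → SStep M (sconf q w P o) sc' → AllBitCells (SConf.output sc') → ⊥
    claim sc' st ag with SStep-deterministic M st (γ-step fq iq)
    ... | refl with ag
    ... | gx ∷ _ = ng gx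

  progress-η : ∀ q w P o g ex oe T → Represents (sconf q w P o) ex oe T → sfinal q ≡ false → sinstr q ≡ stepη g → Progress (sconf q w P o) ex oe T
  progress-η q w P o g ex oe T inv fq iq with g (cur P) in eg
  ... | just (U , col' , d , q') = inj₁ (_ , η-step fq iq eg , simulate-η q w P o g U col' d q' T ex oe inv fq iq eg)
  ... | nothing = inj₂ (claim , dies inv fq λ b e →
          trans (cong (λ z → instrAction b q z ex oe) iq) (trans (cong (λ c → ηAction b (g c) ex oe) e) (cong (λ r → ηAction b r ex oe) eg)))
    where
    claim : ∀ sc' → SStep M (sconf q w P o) sc' → AllBitCells (SConf.output sc') → ⊥
    claim sc' (δ-step _ i _) ag with () ← trans (sym i) iq
    claim sc' (γ-step _ i)   ag with () ← trans (sym i) iq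
    claim sc' (η-step _ i e) ag with trans (sym i) iq
    ... | refl with () ← trans (sym e) eg

  progress : ∀ q w P o ex oe T → Represents (sconf q w P o) ex oe T → sfinal q ≡ false → Progress (sconf q w P o) ex oe T
  progress q w P o ex oe T inv fq with sinstr q in iq
  ... | readIn f = progress-read q w P o f ex oe T inv fq iq
  ... | writeOut i q' = progress-write q w P o i q' ex oe T inv fq iq
  ... | stepη g = progress-η q w P o g ex oe T inv fq iq

  nonFinal : ∀ {q w P o b} → SStep M (sconf q w P o) b → sfinal q ≡ false
  nonFinal (δ-step f _ _) = f
  nonFinal (γ-step f _) = f
  nonFinal (η-step f _ _) = f

  AllBitCells-step : ∀ {a b} → SStep M a b → AllBitCells (SConf.output b) → AllBitCells (SConf.output a)
  AllBitCells-step (δ-step _ _ _) g = g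
  AllBitCells-step (γ-step _ _) (_ ∷ g) = g
  AllBitCells-step (η-step _ _ _) g = g

  AllBitCells-run : ∀ {a b} → Star (SStep M) a b → AllBitCells (SConf.output b) → AllBitCells (SConf.output a)
  AllBitCells-run ε g = g
  AllBitCells-run (s1 ◅ r) g = AllBitCells-step s1 (AllBitCells-run r g)

  simulateRun : ∀ {q w P o c} → Star (SStep M) (sconf q w P o) c → sfinal (SConf.state c) ≡ true → AllBitCells (SConf.output c) →
                ∀ ex oe T → Represents (sconf q w P o) ex oe T →
                Σ (List Bool) λ ob → Σ (Tape Γ) λ T' → Star Step (config (Execute q ex oe) T) (config Stop T')
                                                    × ReadsWord tm T' ob × SConf.output c ≡ outputCells ob
  simulateRun {q} {w} {P} {o} ε fc bits ex oe T inv =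
    let T' , halt , rw = simulate-halt q w P o ex oe T inv fc
    in Represents.ob inv , T' , halt , rw , Represents.eout inv
  simulateRun {q} {w} {P} {o} (s₁ ◅ r) fc bits ex oe T inv = continue (progress q w P o ex oe T inv (nonFinal s₁))
    where
    continue : Progress (sconf q w P o) ex oe T → _
    continue (inj₂ (noBits , _)) = ⊥-elim (noBits _ s₁ (AllBitCells-run r bits))
    continue (inj₁ (sc' , s' , ex' , oe' , T' , (_ , t₁ , r₁) , inv')) with SStep-deterministic M s₁ s'
    ... | refl = let ob , T'' , halt , rw , eo = simulateRun r fc bits ex' oe' T' inv'
                 in ob , T'' , t₁ ◅ (r₁ ◅◅ halt) , rw , eo

  open Deterministic Step (TStep-deterministic tm)

  final-Stop : TM.final tm (code Stop) ≡ true
  final-Stop = cong isFinal (fromFin-toFin State-finite Stop)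

  stm⇒tm : ∀ w v → STMOutputs M w v → TMOutputs tm w v
  stm⇒tm w v (c , run , fc , oc) =
    let T₀ , init , inv₀ = initialise w
        ob , T' , halt , rw , eo = simulateRun run fc (reverse-AllBitCells oc) (null w) false T₀ inv₀
    in config Stop T' , init ◅◅ halt , final-Stop , subst (ReadsWord tm T') (outputCells-injective eo oc) rw

  final-terminal : ∀ h → TM.final tm (TConf.state h) ≡ true → Terminal h
  final-terminal (tconf q T) fh x (t-step f _) with trans (sym fh) f
  ... | ()

  stuck-terminal : ∀ st T → (∀ a → transition st a ≡ nothing) → Terminal (config st T)
  stuck-terminal st T e x (t-step f e') with trans (sym (trans (cong (λ z → codeTransition (transition z (cur T))) (fromFin-toFin State-finite st)) (cong codeTransition (e (cur T))))) e'
  ... | ()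

  Dead-nonfinal : TM.final tm (code Dead) ≢ true
  Dead-nonfinal e with () ← trans (sym e) (cong isFinal (fromFin-toFin State-finite Dead))

  reflectRun : ∀ v n {q w P o ex oe T h} → (r : Star Step (config (Execute q ex oe) T) h) → steps r < n → TM.final tm (TConf.state h) ≡ true →
               ReadsWord tm (TConf.tp h) v → Represents (sconf q w P o) ex oe T →
               Σ (SConf M) λ c → Star (SStep M) (sconf q w P o) c × sfinal (SConf.state c) ≡ true × reverse (SConf.output c) ≡ map bitCell v
  reflectRun v (suc n) {q} {w} {P} {o} {ex} {oe} {T} {h} r (s≤s lt) fh rwh inv with sfinal q in fq
  ... | true =
    let T' , halt , rw = simulate-halt q w P o ex oe T inv fq
        atHalt = terminal-unique r (final-terminal h fh) halt (stuck-terminal Stop T' λ _ → refl)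
    in sconf q w P o , ε , fq ,
       trans (cong reverse (Represents.eout inv))
             (trans (reverse-involutive _) (cong (map bitCell) (ReadsWord-functional rw (subst (λ z → ReadsWord tm (TConf.tp z) v) atHalt rwh))))
  ... | false = continue (progress q w P o ex oe T inv fq)
    where
    continue : Progress (sconf q w P o) ex oe T → _
    continue (inj₁ (sc' , s' , ex' , oe' , T' , (_ , t₁ , r₁) , inv')) =
      let r' , e = remainingRun r (final-terminal h fh) (t₁ ◅ r₁)
          shorter = ≤-trans (s≤s (m≤m+n (steps r') (steps r₁))) (≤-trans (≤-reflexive (trans (sym (+-suc (steps r') (steps r₁))) e)) lt)
          c , run , fc , oc = reflectRun v n r' shorter fh rwh inv'
      in c , s' ◅ run , fc , oc
    continue (inj₂ (_ , T' , dead)) =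
      ⊥-elim (Dead-nonfinal (subst (λ z → TM.final tm (TConf.state z) ≡ true)
                                   (terminal-unique r (final-terminal h fh) dead (stuck-terminal Dead T' λ _ → refl)) fh))

  tm⇒stm : ∀ w v → TMOutputs tm w v → STMOutputs M w v
  tm⇒stm w v (h , run , fh , rwh) =
    let T₀ , init , inv₀ = initialise w
        r' , _ = remainingRun run (final-terminal h fh) init
    in reflectRun v (suc (steps r')) r' ≤-refl fh rwh inv₀

  outputs⇔ : ∀ w v → STMOutputs M w v ⇔ TMOutputs tm w v
  outputs⇔ w v = mk⇔ (stm⇒tm w v) (tm⇒stm w v)

module SameOutputs {s} {N : STM s} {M : TM} (same : ∀ w v → STMOutputs N w v ⇔ TMOutputs M w v) where

  computes⇔ : ∀ F → STMComputes N F ⇔ TMComputes M F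
  computes⇔ F = mk⇔ (λ c w v → ⇔.trans (⇔.sym (same w v)) (c w v)) (λ c w v → ⇔.trans (same w v) (c w v))

  accepts⇔ : ∀ w → STMAccepts N w ⇔ TMAccepts M w
  accepts⇔ w = mk⇔ (Data.Product.map id (Equivalence.to (same w _))) (Data.Product.map id (Equivalence.from (same w _)))

  recognizes⇔ : ∀ Lang → STMRecognizes N Lang ⇔ TMRecognizes M Lang
  recognizes⇔ Lang = mk⇔ (λ r w → ⇔.trans (⇔.sym (accepts⇔ w)) (r w)) (λ r w → ⇔.trans (accepts⇔ w) (r w))

mainTheorem7 : (s : ℕ) →
    ((F : List Bool → List Bool → Set) → Functional F →
       (Σ (STM s) (λ M → STMComputes M F) ⇔ Σ TM (λ M → TMComputes M F)))
    × ((Lang : List Bool → Set) →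
       (Σ (STM s) (λ M → STMRecognizes M Lang) ⇔ Σ TM (λ M → TMRecognizes M Lang)))
mainTheorem7 s =
  -- F need not be functional: machines with the same input/output relation compute the same relations.
  (λ F _ → mk⇔ (λ (N , c) → SimulateSTM.tm N , Equivalence.to (computes⇔ (SimulateSTM.outputs⇔ N) F) c)
               (λ (M , c) → SimulateTM.stm s M , Equivalence.from (computes⇔ (SimulateTM.outputs⇔ s M) F) c)) ,
  (λ Lang → mk⇔ (λ (N , r) → SimulateSTM.tm N , Equivalence.to (recognizes⇔ (SimulateSTM.outputs⇔ N) Lang) r)
                (λ (M , r) → SimulateTM.stm s M , Equivalence.from (recognizes⇔ (SimulateTM.outputs⇔ s M) Lang) r))
  where open SameOutputs using (computes⇔; recognizes⇔)
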